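{- If $N:\langle\Gamma\vdash U\rangle$ is derivable and $M\rhd^*_h N$, then $M:\langle\Gamma\uparrow^M\vdash U\rangle$ is derivable.
   Context: Indexes: finite sequences of natural numbers ($\mathcal L_{\mathbb N}$), $\oslash$ empty, $i::L$ prepending $i$, $L_1\preceq L_2$ (also $L_2\succeq L_1$) iff $L_2=L_1::L_3$ for some $L_3$ (concatenation). Terms: over a countably infinite set $\mathcal V$, terms $\mathcal M$, free indexed variables $\mathrm{fv}$, degree $d$, joinability $\diamond$ defined simultaneously: $x^L\in\mathcal M$ ($\mathrm{fv}=\{x^L\}$, $d=L$); $MN\in\mathcal M$ when $d(M)\preceq d(N)$, $M\diamond N$ ($\mathrm{fv}$ union, $d(MN)=d(M)$); $\lambda x^L.M\in\mathcal M$ when $L\succeq d(M)$ ($\mathrm{fv}(M)\setminus\{x^L\}$, $d=d(M)$). $M\diamond N$ iff $x^L\in\mathrm{fv}(M)$, $x^K\in\mathrm{fv}(N)$ imply $L=K$. Terms modulo $\alpha$; $M[x^L:=N]$ defined only if $M\diamond N$, $d(N)=L$. Weak head reduction: $(\lambda x^L.M)NN_1\dots N_n\rhd_h M[x^L:=N]N_1\dots N_n$ ($n\ge0$); $\rhd^*_h$ its reflexive–transitive closure. Lifting $(x^L)^{+i}=x^{i::L}$, $(M_1M_2)^{+i}=M_1^{+i}M_2^{+i}$, $(\lambda x^L.M)^{+i}=\lambda x^{i::L}.M^{+i}$. Types: atomic types $\mathcal A$, expansion variables $\overline e_0,\overline e_1,\dots$; $\mathbb T\subseteq\mathbb U$ with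 degree: $a\in\mathbb T$ ($d=\oslash$); $U\to T\in\mathbb T$ for $U\in\mathbb U,T\in\mathbb T$ ($d=\oslash$); $\omega^L\in\mathbb U$ ($d=L$); $U_1\sqcap U_2$ if $d(U_1)=d(U_2)$; $\overline e_iU$ ($d=i::d(U)$); modulo $\sqcap$ commutative, associative, idempotent, $\overline e_i(U_1\sqcap U_2)=\overline e_iU_1\sqcap\overline e_iU_2$, $\omega^L\sqcap U=U$ ($d(U)=L$), $\overline e_i\omega^K=\omega^{i::K}$. Environments: finite sets of declarations $x^L:U$ (at most one per $x^L$); $\Gamma,\Delta$ disjoint union; $env^\omega_M$ assigns $\omega^L$ to each $x^L\in\mathrm{fv}(M)$; $\Gamma_1\sqcap\Gamma_2$ intersects types of common variables, keeps others; $\overline e_j\Gamma$ replaces $x^L:U$ by $x^{j::L}:\overline e_jU$; $\Gamma_1\diamond\Gamma_2$ iff $x^L\in\mathrm{dom}\,\Gamma_1$, $x^K\in\mathrm{dom}\,\Gamma_2$ imply $L=K$. If $\mathrm{dom}\,\Gamma\subseteq\mathrm{fv}(M)$, $\Gamma\uparrow^M$ is $\Gamma$ extended with $x^L:\omega^L$ for each $x^L\in\mathrm{fv}(M)\setminus\mathrm{dom}\,\Gamma$. Subtyping $\sqsubseteq$: least relation on types, environments and typings closed under reflexivity, transitivity, $U_1\sqcap U_2\sqsubseteq U_1$ ($d(U_1)=d(U_2)$), $U_1\sqcap U_2\sqsubseteq V_1\sqcap V_2$ if $U_i\sqsubseteq V_i$, $U_1\to T_1\sqsubseteq U_2\to T_2$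 if $U_2\sqsubseteq U_1$, $T_1\sqsubseteq T_2$, $\overline e_iU_1\sqsubseteq\overline e_iU_2$ if $U_1\sqsubseteq U_2$, $\Gamma,y^L:U_1\sqsubseteq\Gamma,y^L:U_2$ if $U_1\sqsubseteq U_2$, $\langle\Gamma_1\vdash U_1\rangle\sqsubseteq\langle\Gamma_2\vdash U_2\rangle$ if $U_1\sqsubseteq U_2$, $\Gamma_2\sqsubseteq\Gamma_1$. Typing rules ($T\in\mathbb T$): (ax) $x^\oslash:\langle(x^\oslash:T)\vdash T\rangle$; ($\omega$) $M:\langle env^\omega_M\vdash\omega^{d(M)}\rangle$; ($\to_I$) $M:\langle\Gamma,(x^L:U)\vdash T\rangle\Rightarrow\lambda x^L.M:\langle\Gamma\vdash U\to T\rangle$; ($\to'_I$) $M:\langle\Gamma\vdash T\rangle$, $x^L\notin\mathrm{dom}\,\Gamma\Rightarrow\lambda x^L.M:\langle\Gamma\vdash\omega^L\to T\rangle$; ($\to_E$) $M_1:\langle\Gamma_1\vdash U\to T\rangle$, $M_2:\langle\Gamma_2\vdash U\rangle$, $\Gamma_1\diamond\Gamma_2\Rightarrow M_1M_2:\langle\Gamma_1\sqcap\Gamma_2\vdash T\rangle$; ($\sqcap_I$) $M:\langle\Gamma\vdash U_1\rangle$, $M:\langle\Gamma\vdash U_2\rangle\Rightarrow M:\langle\Gamma\vdash U_1\sqcap U_2\rangle$; ($e$) $M:\langle\Gamma\vdash U\rangle\Rightarrow M^{+j}:\langle\overline e_j\Gamma\vdash\overline e_jU\rangle$; ($\sqsubseteq$)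 $M:\langle\Gamma\vdash U\rangle$, $\langle\Gamma\vdash U\rangle\sqsubseteq\langle\Gamma'\vdash U'\rangle\Rightarrow M:\langle\Gamma'\vdash U'\rangle$. -}

module Defs where

open import Data.Nat using (ℕ; zero; suc; _≟_)
open import Data.List using (List; []; _∷_; _++_)
open import Data.List.Properties using () renaming (≡-dec to ≡-decL)
open import Data.Product using (_×_; _,_; ∃)
open import Data.Product.Properties using () renaming (≡-dec to ≡-dec×)
open import Data.Maybe using (Maybe; just; nothing; Is-just) renaming (map to mapMaybe)
open import Data.Maybe.Relation.Binary.Pointwise using (Pointwise)
open import Data.Bool using (if_then_else_)
open import Relation.Nullary using (does)
open import Relation.Binary.PropositionalEquality using (_≡_)
open import Relation.Binary.Definitions using (DecidableEquality)
open import Relation.Binary.Construct.Closure.ReflexiveTransitive using (Star)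

Index : Set
Index = List ℕ

_≟ᴵ_ : DecidableEquality Index
_≟ᴵ_ = ≡-decL _≟_

-- an indexed variable x^L is the pair (x , L)
_≟ᵛ_ : DecidableEquality (ℕ × Index)
_≟ᵛ_ = ≡-dec× _≟_ _≟ᴵ_

open import Data.List.Membership.DecPropositional _≟ᵛ_ public using (_∈_; _∉_; _∈?_)

_⪯_ : Index → Index → Set
L₁ ⪯ L₂ = ∃ λ L₃ → L₂ ≡ L₁ ++ L₃

-- Raw terms (locally nameless: free variables named and indexed,
-- bound variables de Bruijn, binders carry the index of the bound variable)

data Tm : Set where
  fvar : ℕ → Index → Tm
  bvar : ℕ → Tm
  app  : Tm → Tm → Tm
  lam  : Index → Tm → Tm

openAt : ℕ → Tm → Tm → Tm
openAt k u (fvar x L) = fvar x L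
openAt k u (bvar i) = if does (i ≟ k) then u else bvar i
openAt k u (app M N) = app (openAt k u M) (openAt k u N)
openAt k u (lam L M) = lam L (openAt (suc k) u M)

-- body of a binder instantiated with u  (M[x^L := u] for the bound x^L)
_^^_ : Tm → Tm → Tm
M ^^ u = openAt 0 u M

fv : Tm → List (ℕ × Index)
fv (fvar x L) = (x , L) ∷ []
fv (bvar _) = []
fv (app M N) = fv M ++ fv N
fv (lam L M) = fv M

-- degree; bound variables get the index stored at their binder
lookupIdx : List Index → ℕ → Index
lookupIdx [] _ = []
lookupIdx (L ∷ Ls) zero = L
lookupIdx (L ∷ Ls) (suc i) = lookupIdx Ls i

degAt : List Index → Tm → Index
degAt ρ (fvar x L) = L
degAt ρ (bvar i) = lookupIdx ρ i
degAt ρ (app M N) = degAt ρ M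
degAt ρ (lam L M) = degAt (L ∷ ρ) M

deg : Tm → Index
deg = degAt []

_⋄_ : Tm → Tm → Set
M ⋄ N = ∀ {x L K} → (x , L) ∈ fv M → (x , K) ∈ fv N → L ≡ K

Fresh : ℕ → Tm → Set
Fresh x M = ∀ L → (x , L) ∉ fv M

data IsTerm : Tm → Set where
  var : ∀ x L → IsTerm (fvar x L)
  app : ∀ {M N} → IsTerm M → IsTerm N → deg M ⪯ deg N → M ⋄ N → IsTerm (app M N)
  lam : ∀ {L M} x → Fresh x M → IsTerm (M ^^ fvar x L) →
        deg (M ^^ fvar x L) ⪯ L → IsTerm (lam L M)

lift : ℕ → Tm → Tm
lift j (fvar x L) = fvar x (j ∷ L)
lift j (bvar i) = bvar i
lift j (app M N) = app (lift j M) (lift j N)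
lift j (lam L M) = lam (j ∷ L) (lift j M)

-- weak head reduction (λx^L.M) N N₁ … Nₙ ▷ M[x^L := N] N₁ … Nₙ,
-- substitution defined only when d(N) = L
data _▷h_ : Tm → Tm → Set where
  β    : ∀ {L M N} → deg N ≡ L → app (lam L M) N ▷h (M ^^ N)
  appL : ∀ {M M' P} → M ▷h M' → app M P ▷h app M' P

_▷h*_ : Tm → Tm → Set
_▷h*_ = Star _▷h_

infixr 7 _⇒_
infixl 8 _⊓_

data Ty : Set where
  atom : ℕ → Ty
  _⇒_  : Ty → Ty → Ty
  ω    : Index → Ty
  _⊓_  : Ty → Ty → Ty
  ē    : ℕ → Ty → Ty

tdeg : Ty → Index
tdeg (atom a) = []
tdeg (U ⇒ T) = []
tdeg (ω L) = L
tdeg (U ⊓ V) = tdeg U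
tdeg (ē i U) = i ∷ tdeg U

data IsT : Ty → Set
data IsU : Ty → Set

data IsT where
  atom : ∀ a → IsT (atom a)
  arr  : ∀ {U T} → IsU U → IsT T → IsT (U ⇒ T)

data IsU where
  ty  : ∀ {T} → IsT T → IsU T
  ω   : ∀ L → IsU (ω L)
  int : ∀ {U V} → IsU U → IsU V → tdeg U ≡ tdeg V → IsU (U ⊓ V)
  exp : ∀ {U} i → IsU U → IsU (ē i U)

-- the equations types are taken modulo
data _≈_ : Ty → Ty → Set where
  ≈-refl  : ∀ {U} → U ≈ U
  ≈-sym   : ∀ {U V} → U ≈ V → V ≈ U
  ≈-trans : ∀ {U V W} → U ≈ V → V ≈ W → U ≈ W
  ⊓-comm  : ∀ {U V} → IsU (U ⊓ V) → (U ⊓ V) ≈ (V ⊓ U)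
  ⊓-assoc : ∀ {U V W} → IsU ((U ⊓ V) ⊓ W) → ((U ⊓ V) ⊓ W) ≈ (U ⊓ (V ⊓ W))
  ⊓-idem  : ∀ {U} → IsU U → (U ⊓ U) ≈ U
  ē-⊓     : ∀ {i U V} → IsU (U ⊓ V) → ē i (U ⊓ V) ≈ (ē i U ⊓ ē i V)
  ω-⊓     : ∀ {L U} → IsU U → tdeg U ≡ L → (ω L ⊓ U) ≈ U
  ē-ω     : ∀ {i K} → ē i (ω K) ≈ ω (i ∷ K)
  cong-⇒  : ∀ {U U' T T'} → U ≈ U' → T ≈ T' → (U ⇒ T) ≈ (U' ⇒ T')
  cong-⊓  : ∀ {U U' V V'} → U ≈ U' → V ≈ V' → (U ⊓ V) ≈ (U' ⊓ V')
  cong-ē  : ∀ {i U U'} → U ≈ U' → ē i U ≈ ē i U'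

data _⊑_ : Ty → Ty → Set where
  ≈⇒⊑    : ∀ {U V} → U ≈ V → U ⊑ V
  ⊑-trans : ∀ {U V W} → U ⊑ V → V ⊑ W → U ⊑ W
  ⊓-elim  : ∀ {U₁ U₂} → tdeg U₁ ≡ tdeg U₂ → (U₁ ⊓ U₂) ⊑ U₁
  ⊓-mono  : ∀ {U₁ U₂ V₁ V₂} → U₁ ⊑ V₁ → U₂ ⊑ V₂ → (U₁ ⊓ U₂) ⊑ (V₁ ⊓ V₂)
  ⇒-mono  : ∀ {U₁ U₂ T₁ T₂} → U₂ ⊑ U₁ → T₁ ⊑ T₂ → (U₁ ⇒ T₁) ⊑ (U₂ ⇒ T₂)
  ē-mono  : ∀ {i U₁ U₂} → U₁ ⊑ U₂ → ē i U₁ ⊑ ē i U₂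

Env : Set
Env = ℕ → Index → Maybe Ty

sgl : ℕ → Index → Ty → Env
sgl x L T y K = if does ((y , K) ≟ᵛ (x , L)) then just T else nothing

-- Γ , (x^L : U)   (used when x^L ∉ dom Γ)
extend : Env → ℕ → Index → Ty → Env
extend Γ x L U y K = if does ((y , K) ≟ᵛ (x , L)) then just U else Γ y K

envω : Tm → Env
envω M y K = if does ((y , K) ∈? fv M) then just (ω K) else nothing

meet : Maybe Ty → Maybe Ty → Maybe Ty
meet (just U) (just V) = just (U ⊓ V)
meet (just U) nothing = just U
meet nothing m = m

_⊓ᴱ_ : Env → Env → Env
(Γ₁ ⊓ᴱ Γ₂) y K = meet (Γ₁ y K) (Γ₂ y K)

ēᴱ : ℕ → Env → Env
ēᴱ j Γ y [] = nothing
ēᴱ j Γ y (i ∷ K) = if does (i ≟ j) then mapMaybe (ē j) (Γ y K) else nothing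

_⋄ᴱ_ : Env → Env → Set
Γ₁ ⋄ᴱ Γ₂ = ∀ {x L K} → Is-just (Γ₁ x L) → Is-just (Γ₂ x K) → L ≡ K

_↑_ : Env → Tm → Env
(Γ ↑ M) y K with Γ y K
... | just U = just U
... | nothing = envω M y K

_⊑ᴱ_ : Env → Env → Set
Γ ⊑ᴱ Δ = ∀ x L → Pointwise _⊑_ (Γ x L) (Δ x L)

WfEnv : Env → Set
WfEnv Γ = ∀ x L U → Γ x L ≡ just U → IsU U

data _∶⟨_⊢_⟩ : Tm → Env → Ty → Set where
  ax   : ∀ {x T} → IsT T → fvar x [] ∶⟨ sgl x [] T ⊢ T ⟩
  ωr   : ∀ {M} → IsTerm M → M ∶⟨ envω M ⊢ ω (deg M) ⟩
  ⇒I   : ∀ {Γ L M U T} x → Fresh x M → Γ x L ≡ nothing → IsTerm (lam L M) → IsT T →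
         (M ^^ fvar x L) ∶⟨ extend Γ x L U ⊢ T ⟩ →
         lam L M ∶⟨ Γ ⊢ U ⇒ T ⟩
  ⇒I'  : ∀ {Γ L M T} x → Fresh x M → Γ x L ≡ nothing → IsTerm (lam L M) → IsT T →
         (M ^^ fvar x L) ∶⟨ Γ ⊢ T ⟩ →
         lam L M ∶⟨ Γ ⊢ ω L ⇒ T ⟩
  ⇒E   : ∀ {Γ₁ Γ₂ M₁ M₂ U T} → M₁ ∶⟨ Γ₁ ⊢ U ⇒ T ⟩ → M₂ ∶⟨ Γ₂ ⊢ U ⟩ → Γ₁ ⋄ᴱ Γ₂ →
         IsTerm (app M₁ M₂) → IsT T →
         app M₁ M₂ ∶⟨ Γ₁ ⊓ᴱ Γ₂ ⊢ T ⟩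
  ⊓I   : ∀ {Γ M U₁ U₂} → M ∶⟨ Γ ⊢ U₁ ⟩ → M ∶⟨ Γ ⊢ U₂ ⟩ → tdeg U₁ ≡ tdeg U₂ →
         M ∶⟨ Γ ⊢ U₁ ⊓ U₂ ⟩
  e    : ∀ {Γ M U} j → M ∶⟨ Γ ⊢ U ⟩ → lift j M ∶⟨ ēᴱ j Γ ⊢ ē j U ⟩
  sub  : ∀ {Γ Γ' M U U'} → M ∶⟨ Γ ⊢ U ⟩ → U ⊑ U' → Γ' ⊑ᴱ Γ → IsU U' → WfEnv Γ' →
         M ∶⟨ Γ' ⊢ U' ⟩

module Submission where

-- The heart of the proof is one β-step (λx^L.B) P ▷h B[x^L := P].  Writing
-- the contractum as C [ z ≔ P ] for a fresh name z, a REVERSE SUBSTITUTION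
-- lemma splits any typing of C [ z ≔ P ] into a typing of C in which z^L
-- has some type V, a typing of P with V, and two environments whose meet lies
-- above the original one.  Rule (→I) on C then types the redex.  If z does
-- not occur in C, rule (→'I) and the ω-typing of P are used instead.
-- Subject expansion for one step follows by induction on the typing of the
-- reduct (going under ē_j by un-lifting terms and reductions), and the
-- corollary by induction on the number of steps.

open import Defs
open import Data.Nat using (ℕ; zero; suc; _≟_; _<_; _≤_; _⊔_; z≤n; s≤s)
import Data.Nat.Properties as NP
open import Data.List using (List; []; _∷_; _++_; length; map)
import Data.List.Properties as LP
open import Data.List.Relation.Unary.Any using (here; there)
open import Data.List.Membership.Propositional.Properties using (∈-++⁻; ∈-++⁺ˡ; ∈-++⁺ʳ)
open import Data.Product using (_×_; _,_; ∃; ∃₂; proj₁; proj₂)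
open import Data.Sum using (_⊎_; inj₁; inj₂; map₂)
open import Data.Empty using (⊥; ⊥-elim)
open import Data.Unit using (⊤; tt)
open import Data.Maybe using (Maybe; just; nothing; Is-just) renaming (map to mapMaybe)
open import Data.Maybe.Relation.Unary.Any using () renaming (just to is-just)
open import Data.Maybe.Relation.Binary.Pointwise using (Pointwise; just; nothing)
open import Data.Bool using (if_then_else_)
open import Relation.Nullary using (yes; no; ¬_; Dec; does)
open import Relation.Nullary.Decidable using (dec-true; dec-false)
open import Relation.Binary.Construct.Closure.ReflexiveTransitive using (ε; _◅_)
open import Relation.Binary.PropositionalEquality

if-yes : ∀ {A P : Set} (d : Dec P) {a b : A} → P → (if does d then a else b) ≡ a
if-yes d p rewrite dec-true d p = refl

if-no : ∀ {A P : Set} (d : Dec P) {a b : A} → ¬ P → (if does d then a else b) ≡ b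
if-no d ¬p rewrite dec-false d ¬p = refl

⪯-refl : ∀ L → L ⪯ L
⪯-refl L = [] , sym (LP.++-identityʳ L)

⪯-trans : ∀ {A B C} → A ⪯ B → B ⪯ C → A ⪯ C
⪯-trans {A} (L₁ , refl) (L₂ , refl) = L₁ ++ L₂ , LP.++-assoc A L₁ L₂

⪯-cons : ∀ j {A B} → A ⪯ B → (j ∷ A) ⪯ (j ∷ B)
⪯-cons j (L , eq) = L , cong (j ∷_) eq

⪯-uncons : ∀ j {A B} → (j ∷ A) ⪯ (j ∷ B) → A ⪯ B
⪯-uncons j (L , eq) = L , LP.∷-injectiveʳ eq

-- Local closure and degrees

lcAt : ℕ → Tm → Set
lcAt n (fvar _ _) = ⊤
lcAt n (bvar i) = i < n
lcAt n (app M N) = lcAt n M × lcAt n N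
lcAt n (lam L M) = lcAt (suc n) M

open-lc : ∀ {n k u} M → lcAt n M → n ≤ k → openAt k u M ≡ M
open-lc (fvar x L) _ _ = refl
open-lc {n} {k} (bvar i) i<n n≤k with i ≟ k
... | yes refl = ⊥-elim (NP.<⇒≱ i<n n≤k)
... | no i≢k = if-no (i ≟ k) i≢k
open-lc (app M N) (lcM , lcN) n≤k = cong₂ app (open-lc M lcM n≤k) (open-lc N lcN n≤k)
open-lc (lam L M) lcM n≤k = cong (lam L) (open-lc M lcM (s≤s n≤k))

lc-open⁻ : ∀ {n k u} M → k ≤ n → lcAt n (openAt k u M) → lcAt (suc n) M
lc-open⁻ (fvar x L) _ _ = tt
lc-open⁻ {n} {k} {u} (bvar i) k≤n lc with i ≟ k
... | yes refl = s≤s k≤n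
... | no i≢k = NP.m≤n⇒m≤1+n (subst (lcAt n) (if-no (i ≟ k) i≢k) lc)
lc-open⁻ (app M N) k≤n (lcM , lcN) = lc-open⁻ M k≤n lcM , lc-open⁻ N k≤n lcN
lc-open⁻ (lam L M) k≤n lcM = lc-open⁻ M (s≤s k≤n) lcM

lookup-++ : ∀ ρ σ i → i < length ρ → lookupIdx (ρ ++ σ) i ≡ lookupIdx ρ i
lookup-++ (L ∷ ρ) σ zero _ = refl
lookup-++ (L ∷ ρ) σ (suc i) (s≤s i<) = lookup-++ ρ σ i i<

degAt-lc : ∀ ρ σ M → lcAt (length ρ) M → degAt (ρ ++ σ) M ≡ degAt ρ M
degAt-lc ρ σ (fvar x L) _ = refl
degAt-lc ρ σ (bvar i) i< = lookup-++ ρ σ i i<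
degAt-lc ρ σ (app M N) (lcM , _) = degAt-lc ρ σ M lcM
degAt-lc ρ σ (lam L M) lcM = degAt-lc (L ∷ ρ) σ M lcM

degAt-closed : ∀ σ M → lcAt 0 M → degAt σ M ≡ deg M
degAt-closed σ M lc = degAt-lc [] σ M lc

lookup-last : ∀ ρ D i → length ρ ≡ i → lookupIdx (ρ ++ D ∷ []) i ≡ D
lookup-last [] D zero refl = refl
lookup-last (L ∷ ρ) D (suc i) eq = lookup-last ρ D i (NP.suc-injective eq)

lookup-not-last : ∀ ρ D i → length ρ ≢ i → lookupIdx ρ i ≡ lookupIdx (ρ ++ D ∷ []) i
lookup-not-last [] D zero ne = ⊥-elim (ne refl)
lookup-not-last [] D (suc i) ne = refl
lookup-not-last (L ∷ ρ) D zero ne = refl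
lookup-not-last (L ∷ ρ) D (suc i) ne = lookup-not-last ρ D i (λ e → ne (cong suc e))

degAt-open : ∀ ρ k u D M → length ρ ≡ k → (∀ σ → degAt σ u ≡ D) →
             degAt ρ (openAt k u M) ≡ degAt (ρ ++ D ∷ []) M
degAt-open ρ k u D (fvar x L) _ _ = refl
degAt-open ρ k u D (bvar i) |ρ|≡k degu with i ≟ k
... | yes refl = trans (cong (degAt ρ) (if-yes (i ≟ i) refl)) (trans (degu ρ) (sym (lookup-last ρ D i |ρ|≡k)))
... | no i≢k = trans (cong (degAt ρ) (if-no (i ≟ k) i≢k)) (lookup-not-last ρ D i (λ e → i≢k (trans (sym e) |ρ|≡k)))
degAt-open ρ k u D (app M N) eq degu = degAt-open ρ k u D M eq degu
degAt-open ρ k u D (lam L M) eq degu = degAt-open (L ∷ ρ) (suc k) u D M (cong suc eq) degu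

deg-open-var : ∀ y L M → deg (M ^^ fvar y L) ≡ degAt (L ∷ []) M
deg-open-var y L M = degAt-open [] 0 (fvar y L) L M refl (λ _ → refl)

-- Free variables and fresh names

fv-open⁻ : ∀ {a} k u M → a ∈ fv (openAt k u M) → a ∈ fv u ⊎ a ∈ fv M
fv-open⁻ k u (fvar x L) a∈ = inj₂ a∈
fv-open⁻ k u (bvar i) a∈ with i ≟ k
... | yes i≡k = inj₁ (subst (λ t → _ ∈ fv t) (if-yes (i ≟ k) i≡k) a∈)
... | no i≢k = inj₂ (subst (λ t → _ ∈ fv t) (if-no (i ≟ k) i≢k) a∈)
fv-open⁻ k u (app M N) a∈ with ∈-++⁻ (fv (openAt k u M)) a∈
... | inj₁ a∈M = map₂ ∈-++⁺ˡ (fv-open⁻ k u M a∈M)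
... | inj₂ a∈N = map₂ (∈-++⁺ʳ (fv M)) (fv-open⁻ k u N a∈N)
fv-open⁻ k u (lam L M) a∈ = fv-open⁻ (suc k) u M a∈

fv-open⁺ : ∀ {a} k u M → a ∈ fv M → a ∈ fv (openAt k u M)
fv-open⁺ k u (fvar x L) a∈ = a∈
fv-open⁺ k u (bvar i) ()
fv-open⁺ k u (app M N) a∈ with ∈-++⁻ (fv M) a∈
... | inj₁ a∈M = ∈-++⁺ˡ (fv-open⁺ k u M a∈M)
... | inj₂ a∈N = ∈-++⁺ʳ (fv (openAt k u M)) (fv-open⁺ k u N a∈N)
fv-open⁺ k u (lam L M) a∈ = fv-open⁺ (suc k) u M a∈

fv-open-var⁻ : ∀ {y K} x L M → (y , K) ≢ (x , L) → (y , K) ∈ fv (M ^^ fvar x L) → (y , K) ∈ fv M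
fv-open-var⁻ x L M ne y∈ with fv-open⁻ 0 (fvar x L) M y∈
... | inj₁ (here eq) = ⊥-elim (ne eq)
... | inj₂ y∈M = y∈M

maxName : List (ℕ × Index) → ℕ
maxName [] = 0
maxName ((x , _) ∷ xs) = x ⊔ maxName xs

maxName-∈ : ∀ {x K xs} → (x , K) ∈ xs → x ≤ maxName xs
maxName-∈ (here refl) = NP.m≤m⊔n _ _
maxName-∈ {xs = (y , _) ∷ xs} (there x∈) = NP.≤-trans (maxName-∈ x∈) (NP.m≤n⊔m y _)

fresh-above : ∀ {y} M → maxName (fv M) < y → Fresh y M
fresh-above M lt L y∈ = NP.<⇒≱ lt (maxName-∈ y∈)

freshFor : Tm → ℕ
freshFor M = suc (maxName (fv M))

freshFor-fresh : ∀ M → Fresh (freshFor M) M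
freshFor-fresh M = fresh-above M (NP.n<1+n _)

freshFor₂ : Tm → Tm → ℕ → ℕ
freshFor₂ B P n = suc (maxName (fv B) ⊔ maxName (fv P) ⊔ n)

freshFor₂-fresh₁ : ∀ B P n → Fresh (freshFor₂ B P n) B
freshFor₂-fresh₁ B P n =
  fresh-above B (s≤s (NP.≤-trans (NP.m≤m⊔n _ (maxName (fv P))) (NP.m≤m⊔n _ n)))

freshFor₂-fresh₂ : ∀ B P n → Fresh (freshFor₂ B P n) P
freshFor₂-fresh₂ B P n =
  fresh-above P (s≤s (NP.≤-trans (NP.m≤n⊔m (maxName (fv B)) _) (NP.m≤m⊔n _ n)))

freshFor₂-above : ∀ B P n → n < freshFor₂ B P n
freshFor₂-above B P n = s≤s (NP.m≤n⊔m (maxName (fv B) ⊔ maxName (fv P)) n)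

-- Renaming free names by finite permutations

swap : ℕ → ℕ → ℕ → ℕ
swap a b x = if does (x ≟ a) then b else (if does (x ≟ b) then a else x)

swap-a : ∀ a b x → x ≡ a → swap a b x ≡ b
swap-a a b x x≡a = if-yes (x ≟ a) x≡a

swap-b : ∀ a b x → x ≢ a → x ≡ b → swap a b x ≡ a
swap-b a b x x≢a x≡b = trans (if-no (x ≟ a) x≢a) (if-yes (x ≟ b) x≡b)

swap-other : ∀ a b x → x ≢ a → x ≢ b → swap a b x ≡ x
swap-other a b x x≢a x≢b = trans (if-no (x ≟ a) x≢a) (if-no (x ≟ b) x≢b)

swap-involutive : ∀ a b x → swap a b (swap a b x) ≡ x
swap-involutive a b x with x ≟ a
swap-involutive a b x | yes refl with b ≟ x
... | yes refl = trans (cong (swap b b) (swap-a b b b refl)) (swap-a b b b refl)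
... | no b≢x = trans (cong (swap x b) (swap-a x b x refl)) (swap-b x b b b≢x refl)
swap-involutive a b x | no x≢a with x ≟ b
... | yes refl = trans (cong (swap a x) (swap-b a x x x≢a refl)) (swap-a a x a refl)
... | no x≢b = trans (cong (swap a b) (swap-other a b x x≢a x≢b)) (swap-other a b x x≢a x≢b)

Perm : Set
Perm = List (ℕ × ℕ)

act : Perm → ℕ → ℕ
act [] x = x
act ((a , b) ∷ π) x = swap a b (act π x)

act-injective : ∀ π {x y} → act π x ≡ act π y → x ≡ y
act-injective [] eq = eq
act-injective ((a , b) ∷ π) {x} {y} eq = act-injective π
  (trans (sym (swap-involutive a b (act π x))) (trans (cong (swap a b) eq) (swap-involutive a b (act π y))))

rename : Perm → Tm → Tm
rename π (fvar x L) = fvar (act π x) L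
rename π (bvar i) = bvar i
rename π (app M N) = app (rename π M) (rename π N)
rename π (lam L M) = lam L (rename π M)

rename-open : ∀ π k u M → rename π (openAt k u M) ≡ openAt k (rename π u) (rename π M)
rename-open π k u (fvar x L) = refl
rename-open π k u (bvar i) with i ≟ k
... | yes i≡k = trans (cong (rename π) (if-yes (i ≟ k) i≡k)) (sym (if-yes (i ≟ k) i≡k))
... | no i≢k = trans (cong (rename π) (if-no (i ≟ k) i≢k)) (sym (if-no (i ≟ k) i≢k))
rename-open π k u (app M N) = cong₂ app (rename-open π k u M) (rename-open π k u N)
rename-open π k u (lam L M) = cong (lam L) (rename-open π (suc k) u M)

fv-rename⁻ : ∀ π {y L} M → (y , L) ∈ fv (rename π M) → ∃ λ x → y ≡ act π x × (x , L) ∈ fv M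
fv-rename⁻ π (fvar x K) (here refl) = x , refl , here refl
fv-rename⁻ π (bvar i) ()
fv-rename⁻ π (app M N) y∈ with ∈-++⁻ (fv (rename π M)) y∈
... | inj₁ y∈M = let (x , eq , x∈) = fv-rename⁻ π M y∈M in x , eq , ∈-++⁺ˡ x∈
... | inj₂ y∈N = let (x , eq , x∈) = fv-rename⁻ π N y∈N in x , eq , ∈-++⁺ʳ (fv M) x∈
fv-rename⁻ π (lam K M) y∈ = fv-rename⁻ π M y∈

degAt-rename : ∀ π ρ M → degAt ρ (rename π M) ≡ degAt ρ M
degAt-rename π ρ (fvar x L) = refl
degAt-rename π ρ (bvar i) = refl
degAt-rename π ρ (app M N) = degAt-rename π ρ M
degAt-rename π ρ (lam L M) = degAt-rename π (L ∷ ρ) M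

rename-id : ∀ M → rename [] M ≡ M
rename-id (fvar x L) = refl
rename-id (bvar i) = refl
rename-id (app M N) = cong₂ app (rename-id M) (rename-id N)
rename-id (lam L M) = cong (lam L) (rename-id M)

rename-∷ : ∀ a b π M → rename ((a , b) ∷ π) M ≡ rename ((a , b) ∷ []) (rename π M)
rename-∷ a b π (fvar x L) = refl
rename-∷ a b π (bvar i) = refl
rename-∷ a b π (app M N) = cong₂ app (rename-∷ a b π M) (rename-∷ a b π N)
rename-∷ a b π (lam L M) = cong (lam L) (rename-∷ a b π M)

rename-fresh : ∀ a b M → Fresh a M → Fresh b M → rename ((a , b) ∷ []) M ≡ M
rename-fresh a b (fvar x L) fa fb =
  cong (λ y → fvar y L) (swap-other a b x (λ { refl → fa L (here refl) }) (λ { refl → fb L (here refl) }))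
rename-fresh a b (bvar i) fa fb = refl
rename-fresh a b (app M N) fa fb =
  cong₂ app (rename-fresh a b M (λ L h → fa L (∈-++⁺ˡ h)) (λ L h → fb L (∈-++⁺ˡ h)))
            (rename-fresh a b N (λ L h → fa L (∈-++⁺ʳ (fv M) h)) (λ L h → fb L (∈-++⁺ʳ (fv M) h)))
rename-fresh a b (lam L M) fa fb = cong (lam L) (rename-fresh a b M fa fb)

Fresh-rename : ∀ π x M → Fresh x M → Fresh (act π x) (rename π M)
Fresh-rename π x M fr L y∈ with fv-rename⁻ π M y∈
... | (x' , eq , x'∈) with act-injective π eq
... | refl = fr L x'∈

⋄-rename : ∀ π M N → M ⋄ N → rename π M ⋄ rename π N
⋄-rename π M N M⋄N x∈M x∈N with fv-rename⁻ π M x∈M | fv-rename⁻ π N x∈N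
... | (x₁ , eq₁ , x₁∈) | (x₂ , eq₂ , x₂∈) with act-injective π (trans (sym eq₁) eq₂)
... | refl = M⋄N x₁∈ x₂∈

-- Terms, cofinitely

-- The definition IsTerm of 𝓜 asks the body of a λ to be a term for ONE
-- fresh name.  IsTermᶜ asks it for EVERY fresh name; this is the form in
-- which inversion is useful.
data IsTermᶜ : Tm → Set where
  var : ∀ x L → IsTermᶜ (fvar x L)
  app : ∀ {M N} → IsTermᶜ M → IsTermᶜ N → deg M ⪯ deg N → M ⋄ N → IsTermᶜ (app M N)
  lam : ∀ {L M} → (∀ y → Fresh y M → IsTermᶜ (M ^^ fvar y L)) → degAt (L ∷ []) M ⪯ L →
        IsTermᶜ (lam L M)

-- Generalising over the
-- renaming is what makes the induction work: in the λ case the one fresh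
-- name x of the given derivation is sent to an arbitrary fresh y by one more swap.
rename-IsTermᶜ : ∀ π {M} → IsTerm M → IsTermᶜ (rename π M)
rename-IsTermᶜ π (var x L) = var _ L
rename-IsTermᶜ π (app {M} {N} tM tN d⪯ M⋄N) =
  app (rename-IsTermᶜ π tM) (rename-IsTermᶜ π tN)
      (subst₂ _⪯_ (sym (degAt-rename π [] M)) (sym (degAt-rename π [] N)) d⪯) (⋄-rename π M N M⋄N)
rename-IsTermᶜ π (lam {L} {M} x fr tM d⪯) = lam body d⪯'
  where
  d⪯' : degAt (L ∷ []) (rename π M) ⪯ L
  d⪯' = subst (_⪯ L) (trans (deg-open-var x L M) (sym (degAt-rename π (L ∷ []) M))) d⪯
  body : ∀ y → Fresh y (rename π M) → IsTermᶜ (rename π M ^^ fvar y L)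
  body y fy = subst IsTermᶜ eq (rename-IsTermᶜ ((act π x , y) ∷ π) tM)
    where
    open ≡-Reasoning
    x' = act π x
    eq : rename ((x' , y) ∷ π) (M ^^ fvar x L) ≡ rename π M ^^ fvar y L
    eq = begin
      rename ((x' , y) ∷ π) (M ^^ fvar x L)                      ≡⟨ rename-∷ x' y π _ ⟩
      rename ((x' , y) ∷ []) (rename π (M ^^ fvar x L))          ≡⟨ cong (rename _) (rename-open π 0 (fvar x L) M) ⟩
      rename ((x' , y) ∷ []) (rename π M ^^ fvar x' L)           ≡⟨ rename-open _ 0 (fvar x' L) (rename π M) ⟩
      rename ((x' , y) ∷ []) (rename π M) ^^ fvar (swap x' y x') L
        ≡⟨ cong₂ (λ t v → t ^^ fvar v L) (rename-fresh x' y (rename π M) (Fresh-rename π x M fr) fy)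
                                         (swap-a x' y x' refl) ⟩
      rename π M ^^ fvar y L                                     ∎

IsTerm→IsTermᶜ : ∀ {M} → IsTerm M → IsTermᶜ M
IsTerm→IsTermᶜ {M} tM = subst IsTermᶜ (rename-id M) (rename-IsTermᶜ [] tM)

IsTermᶜ→IsTerm : ∀ {M} → IsTermᶜ M → IsTerm M
IsTermᶜ→IsTerm (var x L) = var x L
IsTermᶜ→IsTerm (app tM tN d⪯ M⋄N) = app (IsTermᶜ→IsTerm tM) (IsTermᶜ→IsTerm tN) d⪯ M⋄N
IsTermᶜ→IsTerm (lam {L} {M} body d⪯) =
  lam (freshFor M) (freshFor-fresh M) (IsTermᶜ→IsTerm (body _ (freshFor-fresh M)))
      (subst (_⪯ L) (sym (deg-open-var (freshFor M) L M)) d⪯)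

lamᶜ : ∀ {L M} y → Fresh y M → IsTermᶜ (M ^^ fvar y L) → degAt (L ∷ []) M ⪯ L → IsTermᶜ (lam L M)
lamᶜ {L} {M} y fr tMy d⪯ =
  IsTerm→IsTermᶜ (lam y fr (IsTermᶜ→IsTerm tMy) (subst (_⪯ L) (sym (deg-open-var y L M)) d⪯))

IsTermᶜ→lc : ∀ {M} → IsTermᶜ M → lcAt 0 M
IsTermᶜ→lc (var x L) = tt
IsTermᶜ→lc (app tM tN _ _) = IsTermᶜ→lc tM , IsTermᶜ→lc tN
IsTermᶜ→lc (lam {L} {M} body d⪯) = lc-open⁻ M z≤n (IsTermᶜ→lc (body _ (freshFor-fresh M)))

degAt-term : ∀ σ {M} → IsTermᶜ M → degAt σ M ≡ deg M
degAt-term σ {M} tM = degAt-closed σ M (IsTermᶜ→lc tM)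

lamᶜ-body : ∀ {L M} → IsTermᶜ (lam L M) → ∀ y → Fresh y M → IsTermᶜ (M ^^ fvar y L)
lamᶜ-body (lam body _) = body

appᶜ-fun : ∀ {M N} → IsTermᶜ (app M N) → IsTermᶜ M
appᶜ-fun (app tM _ _ _) = tM

appᶜ-arg : ∀ {M N} → IsTermᶜ (app M N) → IsTermᶜ N
appᶜ-arg (app _ tN _ _) = tN

appᶜ-⋄ : ∀ {M N} → IsTermᶜ (app M N) → M ⋄ N
appᶜ-⋄ (app _ _ _ M⋄N) = M⋄N

-- Substitution for a free name

-- C [ z ≔ P ] replaces every free occurrence of the name z (whatever its
-- index) by P.  A β-redex contracts to such a substitution: B ^^ P is
-- (B ^^ z^L) [ z ≔ P ] for z fresh.
infix 25 _[_≔_]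
_[_≔_] : Tm → ℕ → Tm → Tm
fvar x L [ z ≔ P ] = if does (x ≟ z) then P else fvar x L
bvar i [ z ≔ P ] = bvar i
app M N [ z ≔ P ] = app (M [ z ≔ P ]) (N [ z ≔ P ])
lam L M [ z ≔ P ] = lam L (M [ z ≔ P ])

≔-here : ∀ z P L → fvar z L [ z ≔ P ] ≡ P
≔-here z P L = if-yes (z ≟ z) refl

≔-other : ∀ z P x L → x ≢ z → fvar x L [ z ≔ P ] ≡ fvar x L
≔-other z P x L x≢z = if-no (x ≟ z) x≢z

≔-fresh : ∀ z P C → Fresh z C → C [ z ≔ P ] ≡ C
≔-fresh z P (fvar x L) fr = ≔-other z P x L (λ { refl → fr L (here refl) })
≔-fresh z P (bvar i) fr = refl
≔-fresh z P (app M N) fr =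
  cong₂ app (≔-fresh z P M (λ L h → fr L (∈-++⁺ˡ h))) (≔-fresh z P N (λ L h → fr L (∈-++⁺ʳ (fv M) h)))
≔-fresh z P (lam L M) fr = cong (lam L) (≔-fresh z P M fr)

≔-open : ∀ z P k u C → lcAt 0 P → openAt k u C [ z ≔ P ] ≡ openAt k (u [ z ≔ P ]) (C [ z ≔ P ])
≔-open z P k u (fvar x L) lc with x ≟ z
... | yes refl = trans (≔-here x P L)
                   (trans (sym (open-lc P lc z≤n)) (cong (openAt k (u [ x ≔ P ])) (sym (≔-here x P L))))
... | no x≢z = trans (≔-other z P x L x≢z) (cong (openAt k (u [ z ≔ P ])) (sym (≔-other z P x L x≢z)))
≔-open z P k u (bvar i) lc with i ≟ k
... | yes i≡k = trans (cong (_[ z ≔ P ]) (if-yes (i ≟ k) i≡k)) (sym (if-yes (i ≟ k) i≡k))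
... | no i≢k = trans (cong (_[ z ≔ P ]) (if-no (i ≟ k) i≢k)) (sym (if-no (i ≟ k) i≢k))
≔-open z P k u (app M N) lc = cong₂ app (≔-open z P k u M lc) (≔-open z P k u N lc)
≔-open z P k u (lam L M) lc = cong (lam L) (≔-open z P (suc k) u M lc)

open-as-≔ : ∀ z P L B → Fresh z B → lcAt 0 P → B ^^ P ≡ (B ^^ fvar z L) [ z ≔ P ]
open-as-≔ z P L B fr lc =
  sym (trans (≔-open z P 0 (fvar z L) B lc) (cong₂ (openAt 0) (≔-here z P L) (≔-fresh z P B fr)))

≔-open-var : ∀ z P y L C → y ≢ z → lcAt 0 P → C [ z ≔ P ] ^^ fvar y L ≡ (C ^^ fvar y L) [ z ≔ P ]
≔-open-var z P y L C y≢z lc =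
  sym (trans (≔-open z P 0 (fvar y L) C lc) (cong (λ t → openAt 0 t (C [ z ≔ P ])) (≔-other z P y L y≢z)))

degAt-≔ : ∀ z P L ρ C → (∀ σ → degAt σ P ≡ L) → (∀ K → (z , K) ∈ fv C → K ≡ L) →
          degAt ρ (C [ z ≔ P ]) ≡ degAt ρ C
degAt-≔ z P L ρ (fvar x K) degP zL with x ≟ z
... | yes refl = trans (cong (degAt ρ) (≔-here x P K)) (trans (degP ρ) (sym (zL K (here refl))))
... | no x≢z = cong (degAt ρ) (≔-other z P x K x≢z)
degAt-≔ z P L ρ (bvar i) degP zL = refl
degAt-≔ z P L ρ (app M N) degP zL = degAt-≔ z P L ρ M degP (λ K h → zL K (∈-++⁺ˡ h))
degAt-≔ z P L ρ (lam K M) degP zL = degAt-≔ z P L (K ∷ ρ) M degP zL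

fv-≔⁻ : ∀ {x K} z P C → (x , K) ∈ fv (C [ z ≔ P ]) → (x , K) ∈ fv P ⊎ ((x , K) ∈ fv C × x ≢ z)
fv-≔⁻ z P (fvar y L) x∈ with y ≟ z
... | yes refl = inj₁ (subst (λ t → _ ∈ fv t) (≔-here y P L) x∈)
... | no y≢z with subst (λ t → _ ∈ fv t) (≔-other z P y L y≢z) x∈
... | here refl = inj₂ (here refl , y≢z)
fv-≔⁻ z P (bvar i) ()
fv-≔⁻ z P (app M N) x∈ with ∈-++⁻ (fv (M [ z ≔ P ])) x∈
... | inj₁ x∈M = map₂ (λ { (a , b) → ∈-++⁺ˡ a , b }) (fv-≔⁻ z P M x∈M)
... | inj₂ x∈N = map₂ (λ { (a , b) → ∈-++⁺ʳ (fv M) a , b }) (fv-≔⁻ z P N x∈N)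
fv-≔⁻ z P (lam L M) x∈ = fv-≔⁻ z P M x∈

fv-≔⁺ : ∀ {x K} z P C → (x , K) ∈ fv C → x ≢ z → (x , K) ∈ fv (C [ z ≔ P ])
fv-≔⁺ z P (fvar y L) (here refl) y≢z = subst (λ t → _ ∈ fv t) (sym (≔-other z P y L y≢z)) (here refl)
fv-≔⁺ z P (bvar i) ()
fv-≔⁺ z P (app M N) x∈ x≢z with ∈-++⁻ (fv M) x∈
... | inj₁ x∈M = ∈-++⁺ˡ (fv-≔⁺ z P M x∈M x≢z)
... | inj₂ x∈N = ∈-++⁺ʳ (fv (M [ z ≔ P ])) (fv-≔⁺ z P N x∈N x≢z)
fv-≔⁺ z P (lam L M) x∈ x≢z = fv-≔⁺ z P M x∈ x≢z

fv-≔-image : ∀ {a K} z P C → (z , K) ∈ fv C → a ∈ fv P → a ∈ fv (C [ z ≔ P ])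
fv-≔-image z P (fvar y L) (here refl) a∈ = subst (λ t → _ ∈ fv t) (sym (≔-here z P L)) a∈
fv-≔-image z P (bvar i) ()
fv-≔-image z P (app M N) z∈ a∈ with ∈-++⁻ (fv M) z∈
... | inj₁ z∈M = ∈-++⁺ˡ (fv-≔-image z P M z∈M a∈)
... | inj₂ z∈N = ∈-++⁺ʳ (fv (M [ z ≔ P ])) (fv-≔-image z P N z∈N a∈)
fv-≔-image z P (lam L M) z∈ a∈ = fv-≔-image z P M z∈ a∈

≔-eliminates : ∀ z P C K → Fresh z P → (z , K) ∉ fv (C [ z ≔ P ])
≔-eliminates z P C K frP z∈ with fv-≔⁻ z P C z∈
... | inj₁ z∈P = frP K z∈P
... | inj₂ (_ , z≢z) = z≢z refl

-- Lifting

lift-open : ∀ j k u M → lift j (openAt k u M) ≡ openAt k (lift j u) (lift j M)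
lift-open j k u (fvar x L) = refl
lift-open j k u (bvar i) with i ≟ k
... | yes i≡k = trans (cong (lift j) (if-yes (i ≟ k) i≡k)) (sym (if-yes (i ≟ k) i≡k))
... | no i≢k = trans (cong (lift j) (if-no (i ≟ k) i≢k)) (sym (if-no (i ≟ k) i≢k))
lift-open j k u (app M N) = cong₂ app (lift-open j k u M) (lift-open j k u N)
lift-open j k u (lam L M) = cong (lam (j ∷ L)) (lift-open j (suc k) u M)

lift-app⁻¹ : ∀ j {U V} N → app U V ≡ lift j N →
             ∃₂ λ N₁ N₂ → N ≡ app N₁ N₂ × U ≡ lift j N₁ × V ≡ lift j N₂
lift-app⁻¹ j (app N₁ N₂) refl = N₁ , N₂ , refl , refl , refl

lift-lam⁻¹ : ∀ j {L B} N → lam L B ≡ lift j N →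
             ∃₂ λ L' B' → N ≡ lam L' B' × L ≡ j ∷ L' × B ≡ lift j B'
lift-lam⁻¹ j (lam L N) refl = L , N , refl , refl , refl

lift-injective : ∀ j A B → lift j A ≡ lift j B → A ≡ B
lift-injective j (fvar x L) (fvar .x .L) refl = refl
lift-injective j (bvar i) (bvar .i) refl = refl
lift-injective j (app A₁ A₂) B eq with lift-app⁻¹ j B eq
... | (B₁ , B₂ , refl , eq₁ , eq₂) = cong₂ app (lift-injective j A₁ B₁ eq₁) (lift-injective j A₂ B₂ eq₂)
lift-injective j (lam L A) B eq with lift-lam⁻¹ j B eq
... | (L' , B' , refl , eqL , eqB) = cong₂ lam (LP.∷-injectiveʳ eqL) (lift-injective j A B' eqB)
lift-injective j (fvar x L) (bvar i) ()
lift-injective j (fvar x L) (app B₁ B₂) ()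
lift-injective j (fvar x L) (lam K B) ()
lift-injective j (bvar i) (fvar x L) ()
lift-injective j (bvar i) (app B₁ B₂) ()
lift-injective j (bvar i) (lam K B) ()

lift-≔ : ∀ j z P C → lift j (C [ z ≔ P ]) ≡ lift j C [ z ≔ lift j P ]
lift-≔ j z P (fvar x L) with x ≟ z
... | yes refl = trans (cong (lift j) (≔-here x P L)) (sym (≔-here x (lift j P) (j ∷ L)))
... | no x≢z = trans (cong (lift j) (≔-other z P x L x≢z)) (sym (≔-other z (lift j P) x (j ∷ L) x≢z))
lift-≔ j z P (bvar i) = refl
lift-≔ j z P (app M N) = cong₂ app (lift-≔ j z P M) (lift-≔ j z P N)
lift-≔ j z P (lam L M) = cong (lam (j ∷ L)) (lift-≔ j z P M)

fv-lift⁺ : ∀ j {x K} M → (x , K) ∈ fv M → (x , j ∷ K) ∈ fv (lift j M)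
fv-lift⁺ j (fvar y L) (here refl) = here refl
fv-lift⁺ j (bvar i) ()
fv-lift⁺ j (app M N) x∈ with ∈-++⁻ (fv M) x∈
... | inj₁ x∈M = ∈-++⁺ˡ (fv-lift⁺ j M x∈M)
... | inj₂ x∈N = ∈-++⁺ʳ (fv (lift j M)) (fv-lift⁺ j N x∈N)
fv-lift⁺ j (lam L M) x∈ = fv-lift⁺ j M x∈

fv-lift⁻ : ∀ j {x K'} M → (x , K') ∈ fv (lift j M) → ∃ λ K → K' ≡ j ∷ K × (x , K) ∈ fv M
fv-lift⁻ j (fvar y L) (here refl) = L , refl , here refl
fv-lift⁻ j (bvar i) ()
fv-lift⁻ j (app M N) x∈ with ∈-++⁻ (fv (lift j M)) x∈
... | inj₁ x∈M = let (K , eq , m) = fv-lift⁻ j M x∈M in K , eq , ∈-++⁺ˡ m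
... | inj₂ x∈N = let (K , eq , m) = fv-lift⁻ j N x∈N in K , eq , ∈-++⁺ʳ (fv M) m
fv-lift⁻ j (lam L M) x∈ = fv-lift⁻ j M x∈

fv-lift-∷⁻ : ∀ j {x K} M → (x , j ∷ K) ∈ fv (lift j M) → (x , K) ∈ fv M
fv-lift-∷⁻ j {x} M x∈ with fv-lift⁻ j M x∈
... | (K' , eq , m) = subst (λ t → (x , t) ∈ fv M) (sym (LP.∷-injectiveʳ eq)) m

lookup-map : ∀ j ρ i → i < length ρ → lookupIdx (map (j ∷_) ρ) i ≡ j ∷ lookupIdx ρ i
lookup-map j (L ∷ ρ) zero _ = refl
lookup-map j (L ∷ ρ) (suc i) (s≤s i<) = lookup-map j ρ i i<

degAt-lift : ∀ j ρ M → lcAt (length ρ) M → degAt (map (j ∷_) ρ) (lift j M) ≡ j ∷ degAt ρ M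
degAt-lift j ρ (fvar x L) _ = refl
degAt-lift j ρ (bvar i) i< = lookup-map j ρ i i<
degAt-lift j ρ (app M N) (lcM , _) = degAt-lift j ρ M lcM
degAt-lift j ρ (lam L M) lcM = degAt-lift j (L ∷ ρ) M lcM

deg-lift : ∀ j {M} → IsTermᶜ M → deg (lift j M) ≡ j ∷ deg M
deg-lift j {M} tM = degAt-lift j [] M (IsTermᶜ→lc tM)

Fresh-lift⁻ : ∀ j y M → Fresh y (lift j M) → Fresh y M
Fresh-lift⁻ j y M fr L y∈ = fr (j ∷ L) (fv-lift⁺ j M y∈)

Fresh-lift⁺ : ∀ j y M → Fresh y M → Fresh y (lift j M)
Fresh-lift⁺ j y M fr L y∈ = let (K , _ , m) = fv-lift⁻ j M y∈ in fr K m

⋄-lift : ∀ j M N → M ⋄ N → lift j M ⋄ lift j N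
⋄-lift j M N M⋄N x∈M x∈N with fv-lift⁻ j M x∈M | fv-lift⁻ j N x∈N
... | (K₁ , refl , m₁) | (K₂ , refl , m₂) = cong (j ∷_) (M⋄N m₁ m₂)

⋄-unlift : ∀ j M N → lift j M ⋄ lift j N → M ⋄ N
⋄-unlift j M N M⋄N x∈M x∈N = LP.∷-injectiveʳ (M⋄N (fv-lift⁺ j M x∈M) (fv-lift⁺ j N x∈N))

IsTermᶜ-lift : ∀ j {M} → IsTermᶜ M → IsTermᶜ (lift j M)
IsTermᶜ-lift j (var x L) = var x (j ∷ L)
IsTermᶜ-lift j (app {M} {N} tM tN d⪯ M⋄N) =
  app (IsTermᶜ-lift j tM) (IsTermᶜ-lift j tN)
      (subst₂ _⪯_ (sym (deg-lift j tM)) (sym (deg-lift j tN)) (⪯-cons j d⪯)) (⋄-lift j M N M⋄N)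
IsTermᶜ-lift j tλ@(lam {L} {M} body d⪯) =
  lam (λ y fr → subst IsTermᶜ (lift-open j 0 (fvar y L) M) (IsTermᶜ-lift j (body y (Fresh-lift⁻ j y M fr))))
      (subst (_⪯ (j ∷ L)) (sym (degAt-lift j (L ∷ []) M (IsTermᶜ→lc tλ))) (⪯-cons j d⪯))

IsTermᶜ-unlift : ∀ j {X} → IsTermᶜ X → ∀ M → X ≡ lift j M → IsTermᶜ M
IsTermᶜ-unlift j (var x L) (fvar y K) refl = var y K
IsTermᶜ-unlift j (app tA tB d⪯ A⋄B) (app A B) refl =
  app tA' tB' (⪯-uncons j (subst₂ _⪯_ (deg-lift j tA') (deg-lift j tB') d⪯)) (⋄-unlift j A B A⋄B)
  where
  tA' = IsTermᶜ-unlift j tA A refl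
  tB' = IsTermᶜ-unlift j tB B refl
IsTermᶜ-unlift j (lam body d⪯) (lam L B) refl =
  lam body' (⪯-uncons j (subst (_⪯ (j ∷ L)) (degAt-lift j (L ∷ []) B lcB) d⪯))
  where
  body' : ∀ y → Fresh y B → IsTermᶜ (B ^^ fvar y L)
  body' y fr = IsTermᶜ-unlift j (body y (Fresh-lift⁺ j y B fr)) (B ^^ fvar y L) (sym (lift-open j 0 (fvar y L) B))
  lcB : lcAt 1 B
  lcB = lc-open⁻ B z≤n (IsTermᶜ→lc (body' _ (freshFor-fresh B)))

-- Terms whose degree starts with j are lifts

AllIdx : (Index → Set) → Tm → Set
AllIdx P (fvar x L) = P L
AllIdx P (bvar i) = ⊤
AllIdx P (app M N) = AllIdx P M × AllIdx P N
AllIdx P (lam L M) = P L × AllIdx P M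

AllIdx-mono : ∀ {P Q : Index → Set} → (∀ {K} → P K → Q K) → ∀ M → AllIdx P M → AllIdx Q M
AllIdx-mono f (fvar x L) p = f p
AllIdx-mono f (bvar i) p = tt
AllIdx-mono f (app M N) (pM , pN) = AllIdx-mono f M pM , AllIdx-mono f N pN
AllIdx-mono f (lam L M) (pL , pM) = f pL , AllIdx-mono f M pM

AllIdx-open⁻ : ∀ {P} k u M → AllIdx P (openAt k u M) → AllIdx P M
AllIdx-open⁻ k u (fvar x L) p = p
AllIdx-open⁻ k u (bvar i) p = tt
AllIdx-open⁻ k u (app M N) (pM , pN) = AllIdx-open⁻ k u M pM , AllIdx-open⁻ k u N pN
AllIdx-open⁻ k u (lam L M) (pL , pM) = pL , AllIdx-open⁻ (suc k) u M pM

deg-⪯-indices : ∀ {M} → IsTermᶜ M → AllIdx (deg M ⪯_) M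
deg-⪯-indices (var x L) = ⪯-refl L
deg-⪯-indices (app {M} {N} tM tN d⪯ _) = deg-⪯-indices tM , AllIdx-mono (⪯-trans d⪯) N (deg-⪯-indices tN)
deg-⪯-indices (lam {L} {M} body d⪯) =
  d⪯ , AllIdx-open⁻ 0 (fvar y L) M
         (subst (λ t → AllIdx (t ⪯_) (M ^^ fvar y L)) (deg-open-var y L M) (deg-⪯-indices (body y (freshFor-fresh M))))
  where y = freshFor M

StartsWith : ℕ → Index → Set
StartsWith j K = ∃ λ K' → K ≡ j ∷ K'

unlift-AllIdx : ∀ j M → AllIdx (StartsWith j) M → ∃ λ M' → M ≡ lift j M'
unlift-AllIdx j (fvar x L) (K , refl) = fvar x K , refl
unlift-AllIdx j (bvar i) _ = bvar i , refl
unlift-AllIdx j (app M N) (pM , pN) with unlift-AllIdx j M pM | unlift-AllIdx j N pN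
... | (M' , refl) | (N' , refl) = app M' N' , refl
unlift-AllIdx j (lam L M) ((K , refl) , pM) with unlift-AllIdx j M pM
... | (M' , refl) = lam K M' , refl

deg-∷⇒lift : ∀ j K {M} → IsTermᶜ M → deg M ≡ j ∷ K → ∃ λ M' → M ≡ lift j M'
deg-∷⇒lift j K {M} tM eq = unlift-AllIdx j M (AllIdx-mono starts M (deg-⪯-indices tM))
  where
  starts : ∀ {K₂} → deg M ⪯ K₂ → StartsWith j K₂
  starts (L₃ , refl) rewrite eq = K ++ L₃ , refl

-- Terms are closed under substitution

⋄-self : ∀ {M} → IsTermᶜ M → M ⋄ M
⋄-self (var x L) (here refl) (here refl) = refl
⋄-self (app {M} {N} tM tN _ M⋄N) x∈ x∈' with ∈-++⁻ (fv M) x∈ | ∈-++⁻ (fv M) x∈'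
... | inj₁ a | inj₁ b = ⋄-self tM a b
... | inj₁ a | inj₂ b = M⋄N a b
... | inj₂ a | inj₁ b = sym (M⋄N b a)
... | inj₂ a | inj₂ b = ⋄-self tN a b
⋄-self (lam {L} {M} body _) x∈ x∈' =
  ⋄-self (body _ (freshFor-fresh M)) (fv-open⁺ 0 (fvar (freshFor M) L) M x∈) (fv-open⁺ 0 (fvar (freshFor M) L) M x∈')

⋄-≔ : ∀ z {M N P} → IsTermᶜ P → M ⋄ N →
      (∀ {x K K'} → (x , K) ∈ fv M → x ≢ z → (x , K') ∈ fv P → K ≡ K') →
      (∀ {x K K'} → (x , K) ∈ fv N → x ≢ z → (x , K') ∈ fv P → K ≡ K') →
      M [ z ≔ P ] ⋄ N [ z ≔ P ]
⋄-≔ z {M} {N} {P} tP M⋄N joinM joinN x∈M x∈N with fv-≔⁻ z P M x∈M | fv-≔⁻ z P N x∈N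
... | inj₁ a | inj₁ b = ⋄-self tP a b
... | inj₁ a | inj₂ (b , x≢z) = sym (joinN b x≢z a)
... | inj₂ (a , x≢z) | inj₁ b = joinM a x≢z b
... | inj₂ (a , _) | inj₂ (b , _) = M⋄N a b

IsTermᶜ-≔ : ∀ z {C P} → IsTermᶜ C → IsTermᶜ P → (∀ K → (z , K) ∈ fv C → K ≡ deg P) →
            (∀ {x K K'} → (x , K) ∈ fv C → x ≢ z → (x , K') ∈ fv P → K ≡ K') →
            IsTermᶜ (C [ z ≔ P ])
IsTermᶜ-≔ z {fvar x L} {P} (var x L) tP zdeg join with x ≟ z
... | yes refl = subst IsTermᶜ (sym (≔-here x P L)) tP
... | no x≢z = subst IsTermᶜ (sym (≔-other z P x L x≢z)) (var x L)
IsTermᶜ-≔ z {app M N} {P} (app tM tN d⪯ M⋄N) tP zdeg join =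
  app (IsTermᶜ-≔ z tM tP zdegM (λ h → join (∈-++⁺ˡ h)))
      (IsTermᶜ-≔ z tN tP zdegN (λ h → join (∈-++⁺ʳ (fv M) h)))
      (subst₂ _⪯_ (sym (degAt-≔ z P (deg P) [] M degP zdegM)) (sym (degAt-≔ z P (deg P) [] N degP zdegN)) d⪯)
      (⋄-≔ z {M} {N} tP M⋄N (λ h → join (∈-++⁺ˡ h)) (λ h → join (∈-++⁺ʳ (fv M) h)))
  where
  degP : ∀ σ → degAt σ P ≡ deg P
  degP σ = degAt-term σ tP
  zdegM : ∀ K → (z , K) ∈ fv M → K ≡ deg P
  zdegM K h = zdeg K (∈-++⁺ˡ h)
  zdegN : ∀ K → (z , K) ∈ fv N → K ≡ deg P
  zdegN K h = zdeg K (∈-++⁺ʳ (fv M) h)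
IsTermᶜ-≔ z {lam L C} {P} (lam body d⪯) tP zdeg join =
  lamᶜ w frw (subst IsTermᶜ (sym (≔-open-var z P w L C w≢z (IsTermᶜ→lc tP))) ih)
       (subst (_⪯ L) (sym (degAt-≔ z P (deg P) (L ∷ []) C (λ σ → degAt-term σ tP) zdeg)) d⪯)
  where
  w = freshFor₂ C P z
  frC : Fresh w C
  frC = freshFor₂-fresh₁ C P z
  frP : Fresh w P
  frP = freshFor₂-fresh₂ C P z
  w≢z : w ≢ z
  w≢z = NP.>⇒≢ (freshFor₂-above C P z)
  frw : Fresh w (C [ z ≔ P ])
  frw K h with fv-≔⁻ z P C h
  ... | inj₁ a = frP K a
  ... | inj₂ (a , _) = frC K a
  zdeg' : ∀ K → (z , K) ∈ fv (C ^^ fvar w L) → K ≡ deg P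
  zdeg' K h = zdeg K (fv-open-var⁻ w L C (λ eq → w≢z (sym (cong proj₁ eq))) h)
  join' : ∀ {x K K'} → (x , K) ∈ fv (C ^^ fvar w L) → x ≢ z → (x , K') ∈ fv P → K ≡ K'
  join' {x} {K} {K'} h x≢z hP with fv-open⁻ 0 (fvar w L) C h
  ... | inj₁ (here eq) = ⊥-elim (frP K' (subst (λ v → (v , K') ∈ fv P) (cong proj₁ eq) hP))
  ... | inj₂ hC = join hC x≢z hP
  ih : IsTermᶜ ((C ^^ fvar w L) [ z ≔ P ])
  ih = IsTermᶜ-≔ z (body w frC) tP zdeg' join'

-- Weak head reduction

▷-fv : ∀ {M N a} → M ▷h N → a ∈ fv N → a ∈ fv M
▷-fv (β {L} {B} {P} _) a∈ with fv-open⁻ 0 P B a∈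
... | inj₁ a∈P = ∈-++⁺ʳ (fv B) a∈P
... | inj₂ a∈B = ∈-++⁺ˡ a∈B
▷-fv (appL {M} {M'} {P} s) a∈ with ∈-++⁻ (fv M') a∈
... | inj₁ a∈M' = ∈-++⁺ˡ (▷-fv s a∈M')
... | inj₂ a∈P = ∈-++⁺ʳ (fv M) a∈P

▷-deg : ∀ {M N} → IsTermᶜ M → M ▷h N → deg M ≡ deg N
▷-deg (app (lam _ _) tP _ _) (β {L} {B} {P} degP≡L) =
  sym (trans (degAt-open [] 0 P (deg P) B refl (λ σ → degAt-term σ tP)) (cong (λ t → degAt (t ∷ []) B) degP≡L))
▷-deg (app tM _ _ _) (appL s) = ▷-deg tM s

▷-IsTermᶜ : ∀ {M N} → IsTermᶜ M → M ▷h N → IsTermᶜ N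
▷-IsTermᶜ (app {lam L B} {P} (lam body _) tP _ λ⋄P) (β degP≡L) =
  subst IsTermᶜ (sym (open-as-≔ z P L B frB (IsTermᶜ→lc tP))) (IsTermᶜ-≔ z (body z frB) tP zdeg join)
  where
  z = freshFor₂ B P 0
  frB : Fresh z B
  frB = freshFor₂-fresh₁ B P 0
  zdeg : ∀ K → (z , K) ∈ fv (B ^^ fvar z L) → K ≡ deg P
  zdeg K h with fv-open⁻ 0 (fvar z L) B h
  ... | inj₁ (here refl) = sym degP≡L
  ... | inj₂ b = ⊥-elim (frB K b)
  join : ∀ {x K K'} → (x , K) ∈ fv (B ^^ fvar z L) → x ≢ z → (x , K') ∈ fv P → K ≡ K'
  join h x≢z hP with fv-open⁻ 0 (fvar z L) B h
  ... | inj₁ (here refl) = ⊥-elim (x≢z refl)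
  ... | inj₂ b = λ⋄P b hP
▷-IsTermᶜ (app tM tP d⪯ M⋄P) (appL s) =
  app (▷-IsTermᶜ tM s) tP (subst (_⪯ _) (▷-deg tM s) d⪯) (λ h₁ h₂ → M⋄P (▷-fv s h₁) h₂)

unlift-▷ : ∀ j {X Y} → X ▷h Y → ∀ {M N} → IsTermᶜ M → X ≡ lift j M → Y ≡ lift j N → M ▷h N
unlift-▷ j (β {L} {B} {P} eq) {M} {N} tM eqX eqY with lift-app⁻¹ j M eqX
... | (M₁ , P' , refl , eq₁ , refl) with lift-lam⁻¹ j M₁ eq₁
... | (L' , B' , refl , refl , refl) with tM
... | app _ tP _ _ =
  subst (app (lam L' B') P' ▷h_) (lift-injective j (B' ^^ P') N (trans (lift-open j 0 P' B') eqY))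
        (β (LP.∷-injectiveʳ (trans (sym (deg-lift j tP)) eq)))
unlift-▷ j (appL s) {M} {N} tM eqX eqY with lift-app⁻¹ j M eqX
... | (A , Q , refl , refl , refl) with lift-app⁻¹ j N eqY | tM
... | (N₁ , N₂ , refl , eq₁ , eq₂) | app tA _ _ _ =
  subst (λ t → app A Q ▷h app N₁ t) (lift-injective j Q N₂ eq₂) (appL (unlift-▷ j s tA refl eq₁))

-- Degrees of types

⊑-refl : ∀ {U} → U ⊑ U
⊑-refl = ≈⇒⊑ ≈-refl

tdeg-≈ : ∀ {U V} → U ≈ V → tdeg U ≡ tdeg V
tdeg-≈ ≈-refl = refl
tdeg-≈ (≈-sym p) = sym (tdeg-≈ p)
tdeg-≈ (≈-trans p q) = trans (tdeg-≈ p) (tdeg-≈ q)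
tdeg-≈ (⊓-comm (int _ _ eq)) = eq
tdeg-≈ (⊓-assoc _) = refl
tdeg-≈ (⊓-idem _) = refl
tdeg-≈ (ē-⊓ _) = refl
tdeg-≈ (ω-⊓ _ eq) = sym eq
tdeg-≈ ē-ω = refl
tdeg-≈ (cong-⇒ _ _) = refl
tdeg-≈ (cong-⊓ p _) = tdeg-≈ p
tdeg-≈ (cong-ē {i} p) = cong (i ∷_) (tdeg-≈ p)

tdeg-⊑ : ∀ {U V} → U ⊑ V → tdeg U ≡ tdeg V
tdeg-⊑ (≈⇒⊑ p) = tdeg-≈ p
tdeg-⊑ (⊑-trans p q) = trans (tdeg-⊑ p) (tdeg-⊑ q)
tdeg-⊑ (⊓-elim _) = refl
tdeg-⊑ (⊓-mono p _) = tdeg-⊑ p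
tdeg-⊑ (⇒-mono _ _) = refl
tdeg-⊑ (ē-mono {i} p) = cong (i ∷_) (tdeg-⊑ p)

IsT-tdeg : ∀ {T} → IsT T → tdeg T ≡ []
IsT-tdeg (atom a) = refl
IsT-tdeg (arr _ _) = refl

OfDeg : Index → Ty → Set
OfDeg K V = IsU V × tdeg V ≡ K

OfDeg-⊓ : ∀ {K A B} → OfDeg K A → OfDeg K B → OfDeg K (A ⊓ B)
OfDeg-⊓ (uA , dA) (uB , dB) = int uA uB (trans dA (sym dB)) , dA

-- Environments

DomFv : Env → Tm → Set
DomFv Γ M = ∀ x K → (Is-just (Γ x K) → (x , K) ∈ fv M) × ((x , K) ∈ fv M → Is-just (Γ x K))

OptOfDeg : Index → Maybe Ty → Set
OptOfDeg K m = ∀ V → m ≡ just V → OfDeg K V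

OptOfDeg-nothing : ∀ {K} → OptOfDeg K nothing
OptOfDeg-nothing V ()

OptOfDeg-just : ∀ {K V} → OfDeg K V → OptOfDeg K (just V)
OptOfDeg-just g V refl = g

Graded : Env → Set
Graded Γ = ∀ x K → OptOfDeg K (Γ x K)

Graded→WfEnv : ∀ {Γ} → Graded Γ → WfEnv Γ
Graded→WfEnv g x L U eq = proj₁ (g x L U eq)

is-just-≡ : ∀ {m : Maybe Ty} {V} → m ≡ just V → Is-just m
is-just-≡ refl = is-just tt

not-just-≡ : ∀ {m : Maybe Ty} → m ≡ nothing → ¬ Is-just m
not-just-≡ refl ()

not-just→nothing : ∀ (m : Maybe Ty) → ¬ Is-just m → m ≡ nothing
not-just→nothing (just _) ¬j = ⊥-elim (¬j (is-just tt))
not-just→nothing nothing _ = refl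

just-injective : ∀ {A B : Ty} → _≡_ {A = Maybe Ty} (just A) (just B) → A ≡ B
just-injective refl = refl

-- Decisions kept opaque, so that a 'with' on them does not abstract the
-- identical decision inside the definitions of the environments.
opaque
  decVar : (a b : ℕ × Index) → Dec (a ≡ b)
  decVar a b = a ≟ᵛ b

  decFv : (a : ℕ × Index) (xs : List (ℕ × Index)) → Dec (a ∈ xs)
  decFv a xs = a ∈? xs

  decName : (a b : ℕ) → Dec (a ≡ b)
  decName a b = a ≟ b

sgl-yes : ∀ x L T y K → (y , K) ≡ (x , L) → sgl x L T y K ≡ just T
sgl-yes x L T y K eq = if-yes ((y , K) ≟ᵛ (x , L)) eq

sgl-no : ∀ x L T y K → (y , K) ≢ (x , L) → sgl x L T y K ≡ nothing
sgl-no x L T y K ne = if-no ((y , K) ≟ᵛ (x , L)) ne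

extend-yes : ∀ Γ x L U y K → (y , K) ≡ (x , L) → extend Γ x L U y K ≡ just U
extend-yes Γ x L U y K eq = if-yes ((y , K) ≟ᵛ (x , L)) eq

extend-no : ∀ Γ x L U y K → (y , K) ≢ (x , L) → extend Γ x L U y K ≡ Γ y K
extend-no Γ x L U y K ne = if-no ((y , K) ≟ᵛ (x , L)) ne

envω-yes : ∀ M y K → (y , K) ∈ fv M → envω M y K ≡ just (ω K)
envω-yes M y K y∈ = if-yes ((y , K) ∈? fv M) y∈

envω-no : ∀ M y K → (y , K) ∉ fv M → envω M y K ≡ nothing
envω-no M y K y∉ = if-no ((y , K) ∈? fv M) y∉

ēᴱ-yes : ∀ j Γ y K → ēᴱ j Γ y (j ∷ K) ≡ mapMaybe (ē j) (Γ y K)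
ēᴱ-yes j Γ y K = if-yes (j ≟ j) refl

ēᴱ-no : ∀ j Γ y i K → i ≢ j → ēᴱ j Γ y (i ∷ K) ≡ nothing
ēᴱ-no j Γ y i K i≢j = if-no (i ≟ j) i≢j

meet-is-just⁻ : ∀ (a b : Maybe Ty) → Is-just (meet a b) → Is-just a ⊎ Is-just b
meet-is-just⁻ (just _) _ _ = inj₁ (is-just tt)
meet-is-just⁻ nothing b jb = inj₂ jb

meet-is-justˡ : ∀ (a b : Maybe Ty) → Is-just a → Is-just (meet a b)
meet-is-justˡ (just _) (just _) _ = is-just tt
meet-is-justˡ (just _) nothing _ = is-just tt

meet-is-justʳ : ∀ (a b : Maybe Ty) → Is-just b → Is-just (meet a b)
meet-is-justʳ (just _) (just _) _ = is-just tt
meet-is-justʳ nothing (just _) _ = is-just tt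

map-is-just⁻ : ∀ {f : Ty → Ty} (m : Maybe Ty) → Is-just (mapMaybe f m) → Is-just m
map-is-just⁻ (just _) _ = is-just tt

map-is-just⁺ : ∀ {f : Ty → Ty} (m : Maybe Ty) → Is-just m → Is-just (mapMaybe f m)
map-is-just⁺ (just _) _ = is-just tt

map-just⁻ : ∀ (m : Maybe Ty) {f : Ty → Ty} {V} → mapMaybe f m ≡ just V → ∃ λ W → m ≡ just W × V ≡ f W
map-just⁻ (just W) refl = W , refl , refl

pointwise-is-just : ∀ {a b : Maybe Ty} → Pointwise _⊑_ a b → Is-just a → Is-just b
pointwise-is-just (just _) _ = is-just tt

pointwise-is-just⁻ : ∀ {a b : Maybe Ty} → Pointwise _⊑_ a b → Is-just b → Is-just a
pointwise-is-just⁻ (just _) _ = is-just tt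

pointwise-just : ∀ {a b : Maybe Ty} {V} → Pointwise _⊑_ a b → a ≡ just V → ∃ λ W → b ≡ just W × V ⊑ W
pointwise-just (just r) refl = _ , refl , r

OptOfDeg-meet : ∀ {K} (a b : Maybe Ty) → OptOfDeg K a → OptOfDeg K b → OptOfDeg K (meet a b)
OptOfDeg-meet (just A) (just B) gA gB V refl = OfDeg-⊓ (gA A refl) (gB B refl)
OptOfDeg-meet (just A) nothing gA gB V eq = gA V eq
OptOfDeg-meet nothing b gA gB V eq = gB V eq

-- Domains and grading of the environment constructions

DomFv-sgl : ∀ x T → DomFv (sgl x [] T) (fvar x [])
DomFv-sgl x T y K with decVar (y , K) (x , [])
... | yes refl = (λ _ → here refl) , (λ _ → is-just-≡ (sgl-yes x [] T x [] refl))
... | no ne = (λ j → ⊥-elim (not-just-≡ (sgl-no x [] T y K ne) j)) , (λ { (here eq) → ⊥-elim (ne eq) })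

Graded-sgl : ∀ z L {A} → OfDeg L A → Graded (sgl z L A)
Graded-sgl z L {A} g y K V eq with decVar (y , K) (z , L)
... | yes refl = subst (OfDeg L) (just-injective (trans (sym (sgl-yes z L A z L refl)) eq)) g
... | no ne = ⊥-elim (not-just-≡ (sgl-no z L A y K ne) (is-just-≡ eq))

DomFv-envω : ∀ M → DomFv (envω M) M
DomFv-envω M y K with decFv (y , K) (fv M)
... | yes y∈ = (λ _ → y∈) , (λ _ → is-just-≡ (envω-yes M y K y∈))
... | no y∉ = (λ j → ⊥-elim (not-just-≡ (envω-no M y K y∉) j)) , (λ y∈ → ⊥-elim (y∉ y∈))

Graded-envω : ∀ M → Graded (envω M)
Graded-envω M y K V eq with decFv (y , K) (fv M)
... | yes y∈ = subst (OfDeg K) (just-injective (trans (sym (envω-yes M y K y∈)) eq)) (ω K , refl)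
... | no y∉ = ⊥-elim (not-just-≡ (envω-no M y K y∉) (is-just-≡ eq))

DomFv-lam : ∀ {Γ Γ'} x L M → Fresh x M → Γ x L ≡ nothing →
            (∀ y K → (y , K) ≢ (x , L) → Γ' y K ≡ Γ y K) →
            DomFv Γ' (M ^^ fvar x L) → DomFv Γ (lam L M)
DomFv-lam {Γ} {Γ'} x L M fr Γx same dom y K with decVar (y , K) (x , L)
... | yes refl = (λ j → ⊥-elim (not-just-≡ Γx j)) , (λ y∈ → ⊥-elim (fr L y∈))
... | no ne =
  (λ j → fv-open-var⁻ x L M ne (proj₁ (dom y K) (subst Is-just (sym (same y K ne)) j))) ,
  (λ y∈ → subst Is-just (same y K ne) (proj₂ (dom y K) (fv-open⁺ 0 (fvar x L) M y∈)))

DomFv-⊓ᴱ : ∀ {Γ₁ Γ₂ M₁ M₂} → DomFv Γ₁ M₁ → DomFv Γ₂ M₂ → DomFv (Γ₁ ⊓ᴱ Γ₂) (app M₁ M₂)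
DomFv-⊓ᴱ {Γ₁} {Γ₂} {M₁} {M₂} dom₁ dom₂ y K = to , from
  where
  to : Is-just ((Γ₁ ⊓ᴱ Γ₂) y K) → (y , K) ∈ fv (app M₁ M₂)
  to j with meet-is-just⁻ (Γ₁ y K) (Γ₂ y K) j
  ... | inj₁ j₁ = ∈-++⁺ˡ (proj₁ (dom₁ y K) j₁)
  ... | inj₂ j₂ = ∈-++⁺ʳ (fv M₁) (proj₁ (dom₂ y K) j₂)
  from : (y , K) ∈ fv (app M₁ M₂) → Is-just ((Γ₁ ⊓ᴱ Γ₂) y K)
  from y∈ with ∈-++⁻ (fv M₁) y∈
  ... | inj₁ y∈₁ = meet-is-justˡ (Γ₁ y K) (Γ₂ y K) (proj₂ (dom₁ y K) y∈₁)
  ... | inj₂ y∈₂ = meet-is-justʳ (Γ₁ y K) (Γ₂ y K) (proj₂ (dom₂ y K) y∈₂)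

Graded-⊓ᴱ : ∀ {Γ₁ Γ₂ : Env} → Graded Γ₁ → Graded Γ₂ → Graded (Γ₁ ⊓ᴱ Γ₂)
Graded-⊓ᴱ {Γ₁} {Γ₂} g₁ g₂ x K = OptOfDeg-meet (Γ₁ x K) (Γ₂ x K) (g₁ x K) (g₂ x K)

DomFv-ēᴱ : ∀ j {Γ M} → DomFv Γ M → DomFv (ēᴱ j Γ) (lift j M)
DomFv-ēᴱ j {Γ} {M} dom y [] = (λ ()) , λ y∈ → case-nil (fv-lift⁻ j M y∈)
  where
  case-nil : (∃ λ K → [] ≡ j ∷ K × _) → Is-just (ēᴱ j Γ y [])
  case-nil (_ , () , _)
DomFv-ēᴱ j {Γ} {M} dom y (i ∷ K) with decName i j
... | yes refl =
  (λ jy → fv-lift⁺ i M (proj₁ (dom y K) (map-is-just⁻ (Γ y K) (subst Is-just (ēᴱ-yes i Γ y K) jy)))) ,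
  (λ y∈ → subst Is-just (sym (ēᴱ-yes i Γ y K)) (map-is-just⁺ (Γ y K) (proj₂ (dom y K) (fv-lift-∷⁻ i M y∈))))
... | no i≢j =
  (λ jy → ⊥-elim (not-just-≡ (ēᴱ-no j Γ y i K i≢j) jy)) ,
  (λ y∈ → let (_ , eq , _) = fv-lift⁻ j M y∈ in ⊥-elim (i≢j (LP.∷-injectiveˡ eq)))

Graded-ēᴱ : ∀ j {Γ} → Graded Γ → Graded (ēᴱ j Γ)
Graded-ēᴱ j g y [] V ()
Graded-ēᴱ j {Γ} g y (i ∷ K) V eq with decName i j
... | yes refl =
  let (W , eqW , V≡ēW) = map-just⁻ (Γ y K) (trans (sym (ēᴱ-yes i Γ y K)) eq)
      (uW , dW) = g y K W eqW
  in subst (OfDeg (i ∷ K)) (sym V≡ēW) (exp i uW , cong (i ∷_) dW)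
... | no i≢j = ⊥-elim (not-just-≡ (ēᴱ-no j Γ y i K i≢j) (is-just-≡ eq))

DomFv-⊑ᴱ : ∀ {Γ Γ' M} → Γ' ⊑ᴱ Γ → DomFv Γ M → DomFv Γ' M
DomFv-⊑ᴱ Γ'⊑Γ dom y K = (λ j → proj₁ (dom y K) (pointwise-is-just (Γ'⊑Γ y K) j)) ,
                        (λ y∈ → pointwise-is-just⁻ (Γ'⊑Γ y K) (proj₂ (dom y K) y∈))

Graded-⊑ᴱ : ∀ {Γ Γ'} → Γ' ⊑ᴱ Γ → WfEnv Γ' → Graded Γ → Graded Γ'
Graded-⊑ᴱ Γ'⊑Γ wf g y K V eq =
  wf y K V eq , (let (W , eqW , V⊑W) = pointwise-just (Γ'⊑Γ y K) eq in trans (tdeg-⊑ V⊑W) (proj₂ (g y K W eqW)))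

-- Generation: what a derivation guarantees about its judgement

record Generation (M : Tm) (Γ : Env) (U : Ty) : Set where
  field
    term   : IsTermᶜ M
    isU    : IsU U
    degree : tdeg U ≡ deg M
    dom    : DomFv Γ M
    graded : Graded Γ
open Generation

generation : ∀ {M Γ U} → M ∶⟨ Γ ⊢ U ⟩ → Generation M Γ U
generation (ax {x} {T} isT) = record
  { term = var x [] ; isU = ty isT ; degree = IsT-tdeg isT
  ; dom = DomFv-sgl x T ; graded = Graded-sgl x [] (ty isT , IsT-tdeg isT) }
generation (ωr {M} tM) = record
  { term = IsTerm→IsTermᶜ tM ; isU = ω _ ; degree = refl ; dom = DomFv-envω M ; graded = Graded-envω M }
generation (⇒I {Γ} {L} {M} {U} x fr Γx tλ isT D) = record
  { term = IsTerm→IsTermᶜ tλ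
  ; isU = ty (arr (proj₁ (graded G x L U (extend-yes Γ x L U x L refl))) isT)
  ; degree = trans (sym (IsT-tdeg isT)) (trans (degree G) (deg-open-var x L M))
  ; dom = DomFv-lam x L M fr Γx (extend-no Γ x L U) (dom G)
  ; graded = λ y K V eq → graded G y K V (trans (extend-no Γ x L U y K (ne y K V eq)) eq) }
  where
  G = generation D
  ne : ∀ y K V → Γ y K ≡ just V → (y , K) ≢ (x , L)
  ne y K V eq refl = not-just-≡ Γx (is-just-≡ eq)
generation (⇒I' {Γ} {L} {M} x fr Γx tλ isT D) = record
  { term = IsTerm→IsTermᶜ tλ ; isU = ty (arr (ω L) isT)
  ; degree = trans (sym (IsT-tdeg isT)) (trans (degree G) (deg-open-var x L M))
  ; dom = DomFv-lam x L M fr Γx (λ _ _ _ → refl) (dom G) ; graded = graded G }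
  where G = generation D
generation (⇒E {M₁ = M₁} {M₂ = M₂} D₁ D₂ _ tMN isT) = record
  { term = IsTerm→IsTermᶜ tMN ; isU = ty isT ; degree = trans (IsT-tdeg isT) (degree G₁)
  ; dom = DomFv-⊓ᴱ {M₁ = M₁} {M₂ = M₂} (dom G₁) (dom G₂) ; graded = Graded-⊓ᴱ (graded G₁) (graded G₂) }
  where
  G₁ = generation D₁
  G₂ = generation D₂
generation (⊓I D₁ D₂ eq) = record
  { term = term G₁ ; isU = int (isU G₁) (isU (generation D₂)) eq ; degree = degree G₁
  ; dom = dom G₁ ; graded = graded G₁ }
  where G₁ = generation D₁
generation (e {M = M} j D) = record
  { term = IsTermᶜ-lift j (term G) ; isU = exp j (isU G)
  ; degree = trans (cong (j ∷_) (degree G)) (sym (deg-lift j (term G)))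
  ; dom = DomFv-ēᴱ j {M = M} (dom G) ; graded = Graded-ēᴱ j (graded G) }
  where G = generation D
generation (sub {M = M} D U⊑U' Γ'⊑Γ isU' wf) = record
  { term = term G ; isU = isU' ; degree = trans (sym (tdeg-⊑ U⊑U')) (degree G)
  ; dom = DomFv-⊑ᴱ {M = M} Γ'⊑Γ (dom G) ; graded = Graded-⊑ᴱ Γ'⊑Γ wf (graded G) }
  where G = generation D

-- The order on declarations

infix 4 _≼_
_≼_ : Maybe Ty → Maybe Ty → Set
_≼_ = Pointwise _⊑_

≼-refl : ∀ (m : Maybe Ty) → m ≼ m
≼-refl (just _) = just ⊑-refl
≼-refl nothing = nothing

≼-trans : ∀ {a b c : Maybe Ty} → a ≼ b → b ≼ c → a ≼ c
≼-trans (just p) (just q) = just (⊑-trans p q)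
≼-trans nothing nothing = nothing

≡→≼ : ∀ {a b : Maybe Ty} → a ≡ b → a ≼ b
≡→≼ {a} refl = ≼-refl a

retype : ∀ {M Γ Γ' U} → M ∶⟨ Γ ⊢ U ⟩ → (∀ x K → Γ' x K ≼ Γ x K) → Graded Γ' → M ∶⟨ Γ' ⊢ U ⟩
retype D Γ'≼Γ g = sub D ⊑-refl Γ'≼Γ (isU (generation D)) (Graded→WfEnv g)

-- Intersections of types of equal degree form a meet-semilattice under ⊑

⊑-⊓-idem : ∀ {A} → IsU A → A ⊑ (A ⊓ A)
⊑-⊓-idem u = ≈⇒⊑ (≈-sym (⊓-idem u))

⊓-⊑ˡ : ∀ {K A B} → OfDeg K A → OfDeg K B → (A ⊓ B) ⊑ A
⊓-⊑ˡ (_ , dA) (_ , dB) = ⊓-elim (trans dA (sym dB))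

⊓-⊑ʳ : ∀ {K A B} → OfDeg K A → OfDeg K B → (A ⊓ B) ⊑ B
⊓-⊑ʳ gA gB = ⊑-trans (≈⇒⊑ (⊓-comm (proj₁ (OfDeg-⊓ gA gB)))) (⊓-⊑ˡ gB gA)

-- (c ⊓ c') ⊓ (d ⊓ d') ≈ c ⊓ ((c' ⊓ d) ⊓ d') ≈ c ⊓ ((d ⊓ c') ⊓ d') ≈ (c ⊓ d) ⊓ (c' ⊓ d')
⊓-interchange : ∀ {K c d c' d'} → OfDeg K c → OfDeg K d → OfDeg K c' → OfDeg K d' →
                ((c ⊓ c') ⊓ (d ⊓ d')) ≈ ((c ⊓ d) ⊓ (c' ⊓ d'))
⊓-interchange gc gd gc' gd' =
  ≈-trans (⊓-assoc (proj₁ (OfDeg-⊓ (OfDeg-⊓ gc gc') (OfDeg-⊓ gd gd'))))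
  (≈-trans (cong-⊓ ≈-refl
     (≈-trans (≈-sym (⊓-assoc (proj₁ (OfDeg-⊓ (OfDeg-⊓ gc' gd) gd'))))
     (≈-trans (cong-⊓ (⊓-comm (proj₁ (OfDeg-⊓ gc' gd))) ≈-refl)
              (⊓-assoc (proj₁ (OfDeg-⊓ (OfDeg-⊓ gd gc') gd'))))))
   (≈-sym (⊓-assoc (proj₁ (OfDeg-⊓ (OfDeg-⊓ gc gd) (OfDeg-⊓ gc' gd'))))))

-- Reading an absent declaration of x^K as ω^K

⟦_⟧ : Maybe Ty → Index → Ty
⟦ just A ⟧ K = A
⟦ nothing ⟧ K = ω K

OfDeg-⟦⟧ : ∀ {K} m → OptOfDeg K m → OfDeg K (⟦ m ⟧ K)
OfDeg-⟦⟧ (just A) g = g A refl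
OfDeg-⟦⟧ nothing g = ω _ , refl

SameDom : Maybe Ty → Maybe Ty → Set
SameDom a b = (Is-just a → Is-just b) × (Is-just b → Is-just a)

≼→⊑ : ∀ {K a b} → a ≼ b → ⟦ a ⟧ K ⊑ ⟦ b ⟧ K
≼→⊑ (just p) = p
≼→⊑ nothing = ⊑-refl

≼→SameDom : ∀ {a b} → a ≼ b → SameDom a b
≼→SameDom (just _) = (λ _ → is-just tt) , (λ _ → is-just tt)
≼→SameDom nothing = (λ ()) , (λ ())

SameDom→≼ : ∀ {K} (a b : Maybe Ty) → SameDom a b → ⟦ a ⟧ K ⊑ ⟦ b ⟧ K → a ≼ b
SameDom→≼ (just A) (just B) _ p = just p
SameDom→≼ (just A) nothing (to , _) p with to (is-just tt)
... | ()
SameDom→≼ nothing (just B) (_ , from) p with from (is-just tt)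
... | ()
SameDom→≼ nothing nothing _ _ = nothing

-- Reading commutes with meets, because ω^K is a unit for ⊓ at degree K.
⟦meet⟧ : ∀ {K} (a b : Maybe Ty) → OptOfDeg K a → OptOfDeg K b → ⟦ meet a b ⟧ K ≈ (⟦ a ⟧ K ⊓ ⟦ b ⟧ K)
⟦meet⟧ (just A) (just B) gA gB = ≈-refl
⟦meet⟧ (just A) nothing gA gB =
  ≈-sym (≈-trans (⊓-comm (proj₁ (OfDeg-⊓ (gA A refl) (ω _ , refl)))) (ω-⊓ (proj₁ (gA A refl)) (proj₂ (gA A refl))))
⟦meet⟧ nothing (just B) gA gB = ≈-sym (ω-⊓ (proj₁ (gB B refl)) (proj₂ (gB B refl)))
⟦meet⟧ nothing nothing gA gB = ≈-sym (⊓-idem (ω _))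

-- Reading commutes with expansion, because ē_j ω^K ≈ ω^{j ∷ K}; expansion preserves grading.
⟦map-ē⟧ : ∀ j {K} (a : Maybe Ty) → ⟦ mapMaybe (ē j) a ⟧ (j ∷ K) ≈ ē j (⟦ a ⟧ K)
⟦map-ē⟧ j (just A) = ≈-refl
⟦map-ē⟧ j nothing = ≈-sym ē-ω

OptOfDeg-map-ē : ∀ j {K} (a : Maybe Ty) → OptOfDeg K a → OptOfDeg (j ∷ K) (mapMaybe (ē j) a)
OptOfDeg-map-ē j (just A) g V refl = exp j (proj₁ (g A refl)) , cong (j ∷_) (proj₂ (g A refl))

-- Meets of declarations

meet-nothingʳ : ∀ (a : Maybe Ty) → meet a nothing ≡ a
meet-nothingʳ (just _) = refl
meet-nothingʳ nothing = refl

meet-nothing⁻ : ∀ (a b : Maybe Ty) → nothing ≼ meet a b → a ≡ nothing × b ≡ nothing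
meet-nothing⁻ (just _) (just _) ()
meet-nothing⁻ (just _) nothing ()
meet-nothing⁻ nothing (just _) ()
meet-nothing⁻ nothing nothing _ = refl , refl

meet-idem-≼ : ∀ {K} (a : Maybe Ty) → OptOfDeg K a → a ≼ meet a a
meet-idem-≼ (just A) g = just (⊑-⊓-idem (proj₁ (g A refl)))
meet-idem-≼ nothing g = nothing

meet-≼ˡ : ∀ {K} (a b : Maybe Ty) → OptOfDeg K a → OptOfDeg K b → SameDom a b → meet a b ≼ a
meet-≼ˡ (just A) (just B) gA gB _ = just (⊓-⊑ˡ (gA A refl) (gB B refl))
meet-≼ˡ (just A) nothing gA gB (to , _) with to (is-just tt)
... | ()
meet-≼ˡ nothing (just B) gA gB (_ , from) with from (is-just tt)
... | ()
meet-≼ˡ nothing nothing gA gB _ = nothing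

meet-≼ʳ : ∀ {K} (a b : Maybe Ty) → OptOfDeg K a → OptOfDeg K b → SameDom a b → meet a b ≼ b
meet-≼ʳ (just A) (just B) gA gB _ = just (⊓-⊑ʳ (gA A refl) (gB B refl))
meet-≼ʳ (just A) nothing gA gB (to , _) with to (is-just tt)
... | ()
meet-≼ʳ nothing (just B) gA gB (_ , from) with from (is-just tt)
... | ()
meet-≼ʳ nothing nothing gA gB _ = nothing

meet-interchange-≼ : ∀ {K} (a b c d c' d' : Maybe Ty) →
  OptOfDeg K a → OptOfDeg K b → OptOfDeg K c → OptOfDeg K d → OptOfDeg K c' → OptOfDeg K d' →
  a ≼ meet c c' → b ≼ meet d d' → meet a b ≼ meet (meet c d) (meet c' d')
meet-interchange-≼ {K} a b c d c' d' ga gb gc gd gc' gd' a≼ b≼ =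
  SameDom→≼ (meet a b) (meet (meet c d) (meet c' d')) (to , from) readings
  where
  to : Is-just (meet a b) → Is-just (meet (meet c d) (meet c' d'))
  to j with meet-is-just⁻ a b j
  ... | inj₁ ja with meet-is-just⁻ c c' (proj₁ (≼→SameDom a≼) ja)
  ... | inj₁ jc = meet-is-justˡ (meet c d) _ (meet-is-justˡ c d jc)
  ... | inj₂ jc' = meet-is-justʳ (meet c d) _ (meet-is-justˡ c' d' jc')
  to j | inj₂ jb with meet-is-just⁻ d d' (proj₁ (≼→SameDom b≼) jb)
  ... | inj₁ jd = meet-is-justˡ (meet c d) _ (meet-is-justʳ c d jd)
  ... | inj₂ jd' = meet-is-justʳ (meet c d) _ (meet-is-justʳ c' d' jd')
  from : Is-just (meet (meet c d) (meet c' d')) → Is-just (meet a b)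
  from j with meet-is-just⁻ (meet c d) (meet c' d') j
  ... | inj₁ jcd with meet-is-just⁻ c d jcd
  ... | inj₁ jc = meet-is-justˡ a b (proj₂ (≼→SameDom a≼) (meet-is-justˡ c c' jc))
  ... | inj₂ jd = meet-is-justʳ a b (proj₂ (≼→SameDom b≼) (meet-is-justˡ d d' jd))
  from j | inj₂ jc'd' with meet-is-just⁻ c' d' jc'd'
  ... | inj₁ jc' = meet-is-justˡ a b (proj₂ (≼→SameDom a≼) (meet-is-justʳ c c' jc'))
  ... | inj₂ jd' = meet-is-justʳ a b (proj₂ (≼→SameDom b≼) (meet-is-justʳ d d' jd'))
  readings : ⟦ meet a b ⟧ K ⊑ ⟦ meet (meet c d) (meet c' d') ⟧ K
  readings =
    ⊑-trans (≈⇒⊑ (⟦meet⟧ a b ga gb))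
    (⊑-trans (⊓-mono (⊑-trans (≼→⊑ a≼) (≈⇒⊑ (⟦meet⟧ c c' gc gc'))) (⊑-trans (≼→⊑ b≼) (≈⇒⊑ (⟦meet⟧ d d' gd gd'))))
    (⊑-trans (≈⇒⊑ (⊓-interchange (OfDeg-⟦⟧ c gc) (OfDeg-⟦⟧ d gd) (OfDeg-⟦⟧ c' gc') (OfDeg-⟦⟧ d' gd')))
    (≈⇒⊑ (≈-sym (≈-trans (⟦meet⟧ (meet c d) (meet c' d') (OptOfDeg-meet c d gc gd) (OptOfDeg-meet c' d' gc' gd'))
                 (cong-⊓ (⟦meet⟧ c d gc gd) (⟦meet⟧ c' d' gc' gd')))))))

map-ē-≼ : ∀ j {K} (a c d : Maybe Ty) → OptOfDeg K c → OptOfDeg K d → a ≼ meet c d →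
          mapMaybe (ē j) a ≼ meet (mapMaybe (ē j) c) (mapMaybe (ē j) d)
map-ē-≼ j {K} a c d gc gd a≼ = SameDom→≼ _ _ (to , from) readings
  where
  to : Is-just (mapMaybe (ē j) a) → Is-just (meet (mapMaybe (ē j) c) (mapMaybe (ē j) d))
  to j' with meet-is-just⁻ c d (proj₁ (≼→SameDom a≼) (map-is-just⁻ a j'))
  ... | inj₁ jc = meet-is-justˡ (mapMaybe (ē j) c) _ (map-is-just⁺ c jc)
  ... | inj₂ jd = meet-is-justʳ (mapMaybe (ē j) c) _ (map-is-just⁺ d jd)
  from : Is-just (meet (mapMaybe (ē j) c) (mapMaybe (ē j) d)) → Is-just (mapMaybe (ē j) a)
  from j' with meet-is-just⁻ (mapMaybe (ē j) c) (mapMaybe (ē j) d) j'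
  ... | inj₁ jc = map-is-just⁺ a (proj₂ (≼→SameDom a≼) (meet-is-justˡ c d (map-is-just⁻ c jc)))
  ... | inj₂ jd = map-is-just⁺ a (proj₂ (≼→SameDom a≼) (meet-is-justʳ c d (map-is-just⁻ d jd)))
  readings : ⟦ mapMaybe (ē j) a ⟧ (j ∷ K) ⊑ ⟦ meet (mapMaybe (ē j) c) (mapMaybe (ē j) d) ⟧ (j ∷ K)
  readings =
    ⊑-trans (≈⇒⊑ (⟦map-ē⟧ j a))
    (⊑-trans (ē-mono (⊑-trans (≼→⊑ a≼) (≈⇒⊑ (⟦meet⟧ c d gc gd))))
    (≈⇒⊑ (≈-sym (≈-trans (⟦meet⟧ (mapMaybe (ē j) c) (mapMaybe (ē j) d) (OptOfDeg-map-ē j c gc) (OptOfDeg-map-ē j d gd))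
               (≈-trans (cong-⊓ (⟦map-ē⟧ j c) (⟦map-ē⟧ j d))
                        (≈-sym (ē-⊓ (proj₁ (OfDeg-⊓ (OfDeg-⟦⟧ c gc) (OfDeg-⟦⟧ d gd))))))))))

-- Two typings of the same term combine into one of the intersection

⊓I-⊓ᴱ : ∀ {M Γ₁ Γ₂ U₁ U₂} → M ∶⟨ Γ₁ ⊢ U₁ ⟩ → M ∶⟨ Γ₂ ⊢ U₂ ⟩ → tdeg U₁ ≡ tdeg U₂ → M ∶⟨ Γ₁ ⊓ᴱ Γ₂ ⊢ U₁ ⊓ U₂ ⟩
⊓I-⊓ᴱ {M} {Γ₁} {Γ₂} D₁ D₂ eq =
  ⊓I (retype D₁ (λ x K → meet-≼ˡ (Γ₁ x K) (Γ₂ x K) (graded G₁ x K) (graded G₂ x K) (same x K)) g)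
     (retype D₂ (λ x K → meet-≼ʳ (Γ₁ x K) (Γ₂ x K) (graded G₁ x K) (graded G₂ x K) (same x K)) g)
     eq
  where
  G₁ = generation D₁
  G₂ = generation D₂
  g = Graded-⊓ᴱ (graded G₁) (graded G₂)
  -- both environments have domain fv M
  same : ∀ x K → SameDom (Γ₁ x K) (Γ₂ x K)
  same x K = (λ j → proj₂ (dom G₂ x K) (proj₁ (dom G₁ x K) j)) , (λ j → proj₂ (dom G₁ x K) (proj₁ (dom G₂ x K) j))

⋄ᴱ-DomFv : ∀ {Γ₁ Γ₂ M₁ M₂} → DomFv Γ₁ M₁ → DomFv Γ₂ M₂ → M₁ ⋄ M₂ → Γ₁ ⋄ᴱ Γ₂
⋄ᴱ-DomFv dom₁ dom₂ M₁⋄M₂ j₁ j₂ = M₁⋄M₂ (proj₁ (dom₁ _ _) j₁) (proj₁ (dom₂ _ _) j₂)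

⇒E' : ∀ {Γ₁ Γ₂ M₁ M₂ U T} → M₁ ∶⟨ Γ₁ ⊢ U ⇒ T ⟩ → M₂ ∶⟨ Γ₂ ⊢ U ⟩ →
      IsTermᶜ (app M₁ M₂) → IsT T → app M₁ M₂ ∶⟨ Γ₁ ⊓ᴱ Γ₂ ⊢ T ⟩
⇒E' {M₁ = M₁} {M₂ = M₂} D₁ D₂ tM isT =
  ⇒E D₁ D₂ (⋄ᴱ-DomFv {M₁ = M₁} {M₂ = M₂} (dom (generation D₁)) (dom (generation D₂)) (appᶜ-⋄ tM))
     (IsTermᶜ→IsTerm tM) isT

-- Extending an environment to the free variables of a term

just-or-nothing : ∀ (m : Maybe Ty) → (∃ λ A → m ≡ just A) ⊎ (m ≡ nothing)
just-or-nothing (just A) = inj₁ (A , refl)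
just-or-nothing nothing = inj₂ refl

↑-just : ∀ {Γ : Env} {M x K A} → Γ x K ≡ just A → (Γ ↑ M) x K ≡ just A
↑-just {Γ} {M} {x} {K} eq rewrite eq = refl

↑-nothing : ∀ {Γ : Env} {M x K} → Γ x K ≡ nothing → (Γ ↑ M) x K ≡ envω M x K
↑-nothing {Γ} {M} {x} {K} eq rewrite eq = refl

Graded-↑ : ∀ {Γ} M → Graded Γ → Graded (Γ ↑ M)
Graded-↑ {Γ} M g x K V eq with just-or-nothing (Γ x K)
... | inj₁ (A , eqA) = subst (OfDeg K) (just-injective (trans (sym (↑-just {Γ} {M} eqA)) eq)) (g x K A eqA)
... | inj₂ eqN = Graded-envω M x K V (trans (sym (↑-nothing {Γ} {M} eqN)) eq)

retype-≡ : ∀ {M Γ Γ' U} → M ∶⟨ Γ ⊢ U ⟩ → (∀ x K → Γ' x K ≡ Γ x K) → M ∶⟨ Γ' ⊢ U ⟩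
retype-≡ D Γ'≡Γ = retype D (λ x K → ≡→≼ (Γ'≡Γ x K))
  (λ x K V eq → graded (generation D) x K V (trans (sym (Γ'≡Γ x K)) eq))

↑-DomFv : ∀ {Γ M} → DomFv Γ M → ∀ x K → (Γ ↑ M) x K ≡ Γ x K
↑-DomFv {Γ} {M} dom x K with just-or-nothing (Γ x K)
... | inj₁ (A , eqA) = trans (↑-just {Γ} {M} eqA) (sym eqA)
... | inj₂ eqN = trans (↑-nothing {Γ} {M} eqN)
                   (trans (envω-no M x K (λ x∈ → not-just-≡ eqN (proj₂ (dom x K) x∈))) (sym eqN))

↑-↑ : ∀ {Γ M N} → (∀ {a} → a ∈ fv N → a ∈ fv M) → ∀ x K → (Γ ↑ M) x K ≡ ((Γ ↑ N) ↑ M) x K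
↑-↑ {Γ} {M} {N} N⊆M x K with just-or-nothing (Γ x K)
... | inj₁ (A , eqA) = trans (↑-just {Γ} {M} eqA) (sym (↑-just {Γ ↑ N} {M} (↑-just {Γ} {N} eqA)))
... | inj₂ eqN with decFv (x , K) (fv N)
...   | yes x∈N = trans (↑-nothing {Γ} {M} eqN) (trans (envω-yes M x K (N⊆M x∈N))
                    (sym (↑-just {Γ ↑ N} {M} (trans (↑-nothing {Γ} {N} eqN) (envω-yes N x K x∈N)))))
...   | no x∉N = trans (↑-nothing {Γ} {M} eqN)
                   (sym (↑-nothing {Γ ↑ N} {M} (trans (↑-nothing {Γ} {N} eqN) (envω-no N x K x∉N))))

envω-↑ : ∀ N M → (∀ {a} → a ∈ fv N → a ∈ fv M) → ∀ x K → (envω N ↑ M) x K ≡ envω M x K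
envω-↑ N M N⊆M x K with decFv (x , K) (fv N)
... | yes x∈N = trans (↑-just {envω N} {M} (envω-yes N x K x∈N)) (sym (envω-yes M x K (N⊆M x∈N)))
... | no x∉N = ↑-nothing {envω N} {M} (envω-no N x K x∉N)

↑-mono : ∀ {Γ Γ' : Env} M x K → Γ' x K ≼ Γ x K → (Γ' ↑ M) x K ≼ (Γ ↑ M) x K
↑-mono {Γ} {Γ'} M x K Γ'≼Γ with just-or-nothing (Γ' x K) | just-or-nothing (Γ x K)
... | inj₁ (A , eqA) | inj₁ (B , eqB) =
  subst₂ _≼_ (sym (↑-just {Γ'} {M} eqA)) (sym (↑-just {Γ} {M} eqB)) (subst₂ _≼_ eqA eqB Γ'≼Γ)
... | inj₁ (A , eqA) | inj₂ eqB with subst₂ _≼_ eqA eqB Γ'≼Γ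
...   | ()
↑-mono {Γ} {Γ'} M x K Γ'≼Γ | inj₂ eqA | inj₁ (B , eqB) with subst₂ _≼_ eqA eqB Γ'≼Γ
...   | ()
↑-mono {Γ} {Γ'} M x K Γ'≼Γ | inj₂ eqA | inj₂ eqB =
  ≡→≼ (trans (↑-nothing {Γ'} {M} eqA) (sym (↑-nothing {Γ} {M} eqB)))

envω-lift : ∀ j M y K → envω (lift j M) y (j ∷ K) ≼ mapMaybe (ē j) (envω M y K)
envω-lift j M y K with decFv (y , K) (fv M)
... | yes y∈ = subst₂ _≼_ (sym (envω-yes (lift j M) y (j ∷ K) (fv-lift⁺ j M y∈)))
                          (sym (cong (mapMaybe (ē j)) (envω-yes M y K y∈)))
                          (just (≈⇒⊑ (≈-sym ē-ω)))
... | no y∉ = ≡→≼ (trans (envω-no (lift j M) y (j ∷ K) (λ y∈ → y∉ (fv-lift-∷⁻ j M y∈)))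
                        (sym (cong (mapMaybe (ē j)) (envω-no M y K y∉))))

↑-ēᴱ-∷ : ∀ j (Γ : Env) M y K → (ēᴱ j Γ ↑ lift j M) y (j ∷ K) ≼ ēᴱ j (Γ ↑ M) y (j ∷ K)
↑-ēᴱ-∷ j Γ M y K with just-or-nothing (Γ y K)
... | inj₁ (A , eqA) =
  ≡→≼ (trans (↑-just {ēᴱ j Γ} {lift j M} {y} {j ∷ K} (trans (ēᴱ-yes j Γ y K) (cong (mapMaybe (ē j)) eqA)))
             (sym (trans (ēᴱ-yes j (Γ ↑ M) y K) (cong (mapMaybe (ē j)) (↑-just {Γ} {M} eqA)))))
... | inj₂ eqN = subst₂ _≼_ (sym lhs) (sym rhs) (envω-lift j M y K)
  where
  lhs : (ēᴱ j Γ ↑ lift j M) y (j ∷ K) ≡ envω (lift j M) y (j ∷ K)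
  lhs = ↑-nothing {ēᴱ j Γ} {lift j M} {y} {j ∷ K} (trans (ēᴱ-yes j Γ y K) (cong (mapMaybe (ē j)) eqN))
  rhs : ēᴱ j (Γ ↑ M) y (j ∷ K) ≡ mapMaybe (ē j) (envω M y K)
  rhs = trans (ēᴱ-yes j (Γ ↑ M) y K) (cong (mapMaybe (ē j)) (↑-nothing {Γ} {M} eqN))

↑-ēᴱ : ∀ j (Γ : Env) M y K → (ēᴱ j Γ ↑ lift j M) y K ≼ ēᴱ j (Γ ↑ M) y K
↑-ēᴱ j Γ M y [] =
  ≡→≼ (trans (↑-nothing {ēᴱ j Γ} {lift j M} refl) (envω-no (lift j M) y [] (λ y∈ → no-nil (fv-lift⁻ j M y∈))))
  where
  no-nil : (∃ λ K → [] ≡ j ∷ K × _) → ⊥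
  no-nil (_ , () , _)
↑-ēᴱ j Γ M y (i ∷ K) with decName i j
... | yes refl = ↑-ēᴱ-∷ i Γ M y K
... | no i≢j =
  ≡→≼ (trans (↑-nothing {ēᴱ j Γ} {lift j M} {y} {i ∷ K} (ēᴱ-no j Γ y i K i≢j))
      (trans (envω-no (lift j M) y (i ∷ K) (λ y∈ → let (_ , eq , _) = fv-lift⁻ j M y∈ in i≢j (LP.∷-injectiveˡ eq)))
             (sym (ēᴱ-no j (Γ ↑ M) y i K i≢j))))

↑-⊓ᴱ : ∀ (Γ₁ Γ₂ : Env) M P x K → DomFv Γ₂ P → OptOfDeg K (Γ₂ x K) →
       ((Γ₁ ⊓ᴱ Γ₂) ↑ app M P) x K ≼ ((Γ₁ ↑ M) ⊓ᴱ Γ₂) x K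
↑-⊓ᴱ Γ₁ Γ₂ M P x K dom₂ g₂ with just-or-nothing (Γ₁ x K) | just-or-nothing (Γ₂ x K)
... | inj₁ (A , eq₁) | inj₁ (B , eq₂) =
  ≡→≼ (trans (↑-just {Γ₁ ⊓ᴱ Γ₂} {app M P} (cong₂ meet eq₁ eq₂)) (sym (cong₂ meet (↑-just {Γ₁} {M} eq₁) eq₂)))
... | inj₁ (A , eq₁) | inj₂ eq₂ =
  ≡→≼ (trans (↑-just {Γ₁ ⊓ᴱ Γ₂} {app M P} (cong₂ meet eq₁ eq₂)) (sym (cong₂ meet (↑-just {Γ₁} {M} eq₁) eq₂)))
... | inj₂ eq₁ | inj₁ (B , eq₂) with decFv (x , K) (fv M)
...   | yes x∈M = subst₂ _≼_ (sym (↑-just {Γ₁ ⊓ᴱ Γ₂} {app M P} (cong₂ meet eq₁ eq₂)))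
                             (sym (cong₂ meet (trans (↑-nothing {Γ₁} {M} eq₁) (envω-yes M x K x∈M)) eq₂))
                             (just (≈⇒⊑ (≈-sym (ω-⊓ (proj₁ (g₂ B eq₂)) (proj₂ (g₂ B eq₂))))))
...   | no x∉M = ≡→≼ (trans (↑-just {Γ₁ ⊓ᴱ Γ₂} {app M P} (cong₂ meet eq₁ eq₂))
                     (sym (cong₂ meet (trans (↑-nothing {Γ₁} {M} eq₁) (envω-no M x K x∉M)) eq₂)))
↑-⊓ᴱ Γ₁ Γ₂ M P x K dom₂ g₂ | inj₂ eq₁ | inj₂ eq₂ =
  ≡→≼ (trans (↑-nothing {Γ₁ ⊓ᴱ Γ₂} {app M P} (cong₂ meet eq₁ eq₂)) (trans envω-app
       (sym (trans (cong₂ meet (↑-nothing {Γ₁} {M} eq₁) eq₂) (meet-nothingʳ (envω M x K))))))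
  where
  x∉P : (x , K) ∉ fv P
  x∉P x∈ = not-just-≡ eq₂ (proj₂ (dom₂ x K) x∈)
  envω-app : envω (app M P) x K ≡ envω M x K
  envω-app with decFv (x , K) (fv M)
  ... | yes x∈M = trans (envω-yes (app M P) x K (∈-++⁺ˡ x∈M)) (sym (envω-yes M x K x∈M))
  ... | no x∉M = trans (envω-no (app M P) x K x∉MP) (sym (envω-no M x K x∉M))
    where
    x∉MP : (x , K) ∉ fv (app M P)
    x∉MP x∈ with ∈-++⁻ (fv M) x∈
    ... | inj₁ x∈M = x∉M x∈M
    ... | inj₂ x∈P = x∉P x∈P

-- A variable can be given any type of its degree

sgl-ω : ∀ z L y K → sgl z L (ω L) y K ≡ envω (fvar z L) y K
sgl-ω z L y K with decVar (y , K) (z , L)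
... | yes refl = trans (sgl-yes z L (ω L) z L refl) (sym (envω-yes (fvar z L) z L (here refl)))
... | no ne = trans (sgl-no z L (ω L) y K ne) (sym (envω-no (fvar z L) y K (λ { (here eq) → ne eq })))

sgl-ē : ∀ z i L U y K → sgl z (i ∷ L) (ē i U) y K ≡ ēᴱ i (sgl z L U) y K
sgl-ē z i L U y [] = sgl-no z (i ∷ L) (ē i U) y [] (λ ())
sgl-ē z i L U y (k ∷ K) with decName k i
... | no k≢i = trans (sgl-no z (i ∷ L) (ē i U) y (k ∷ K) (λ eq → k≢i (LP.∷-injectiveˡ (cong proj₂ eq))))
                     (sym (ēᴱ-no i (sgl z L U) y k K k≢i))
... | yes refl with decVar (y , K) (z , L)
...   | yes refl = trans (sgl-yes z (k ∷ L) (ē k U) z (k ∷ L) refl)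
                     (sym (trans (ēᴱ-yes k (sgl z L U) z L) (cong (mapMaybe (ē k)) (sgl-yes z L U z L refl))))
...   | no ne = trans (sgl-no z (k ∷ L) (ē k U) y (k ∷ K) (λ eq → ne (cong₂ _,_ (cong proj₁ eq) (LP.∷-injectiveʳ (cong proj₂ eq)))))
                  (sym (trans (ēᴱ-yes k (sgl z L U) y K) (cong (mapMaybe (ē k)) (sgl-no z L U y K ne))))

sgl-mono : ∀ z L {A B} → A ⊑ B → ∀ y K → sgl z L A y K ≼ sgl z L B y K
sgl-mono z L {A} {B} A⊑B y K with decVar (y , K) (z , L)
... | yes eq = subst₂ _≼_ (sym (sgl-yes z L A y K eq)) (sym (sgl-yes z L B y K eq)) (just A⊑B)
... | no ne = subst₂ _≼_ (sym (sgl-no z L A y K ne)) (sym (sgl-no z L B y K ne)) nothing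

var-any-type : ∀ z {U} → IsU U → fvar z (tdeg U) ∶⟨ sgl z (tdeg U) U ⊢ U ⟩
var-any-type z (ty isT) rewrite IsT-tdeg isT = ax isT
var-any-type z (ω L) = retype-≡ (ωr (var z L)) (sgl-ω z L)
var-any-type z (int {U} {V} u v eq) =
  ⊓I (retype (var-any-type z u) (sgl-mono z (tdeg U) (⊓-⊑ˡ gU gV)) g)
     (retype (subst (λ t → fvar z t ∶⟨ sgl z t V ⊢ V ⟩) (sym eq) (var-any-type z v)) (sgl-mono z (tdeg U) (⊓-⊑ʳ gU gV)) g)
     eq
  where
  gU : OfDeg (tdeg U) U
  gU = u , refl
  gV : OfDeg (tdeg U) V
  gV = v , sym eq
  g = Graded-sgl z (tdeg U) (OfDeg-⊓ gU gV)
var-any-type z (exp {U} i u) = retype-≡ (e i (var-any-type z u)) (sgl-ē z i (tdeg U) U)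

del : ℕ → Index → Env → Env
del z L Δ y K = if does ((y , K) ≟ᵛ (z , L)) then nothing else Δ y K

del-yes : ∀ z L Δ y K → (y , K) ≡ (z , L) → del z L Δ y K ≡ nothing
del-yes z L Δ y K eq = if-yes ((y , K) ≟ᵛ (z , L)) eq

del-no : ∀ z L Δ y K → (y , K) ≢ (z , L) → del z L Δ y K ≡ Δ y K
del-no z L Δ y K ne = if-no ((y , K) ≟ᵛ (z , L)) ne

extend-del : ∀ Δ x L V → Δ x L ≡ just V → ∀ y K → extend (del x L Δ) x L V y K ≡ Δ y K
extend-del Δ x L V Δx y K with decVar (y , K) (x , L)
... | yes refl = trans (extend-yes (del x L Δ) x L V x L refl) (sym Δx)
... | no ne = trans (extend-no (del x L Δ) x L V y K ne) (del-no x L Δ y K ne)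

-- Reverse substitution

-- The situation of C [ z ≔ P ] in a β-contraction: z is fresh for P and
-- occurs in C, always with index L = deg P.
record Site (z : ℕ) (L : Index) (P C : Tm) : Set where
  field
    termC  : IsTermᶜ C
    termP  : IsTermᶜ P
    degP   : deg P ≡ L
    freshP : Fresh z P
    occurs : (z , L) ∈ fv C
    onlyL  : ∀ K → (z , K) ∈ fv C → K ≡ L
open Site

degAt-P : ∀ {z L P C} → Site z L P C → ∀ σ → degAt σ P ≡ L
degAt-P s σ = trans (degAt-term σ (termP s)) (degP s)

-- A typing of C [ z ≔ P ] splits into a typing of C where z has some type V,
-- a typing of P with V, and environments whose meet is above the given one
-- (away from z, which is not in the domain of the given environment).
record Unsubst (z : ℕ) (L : Index) (P C : Tm) (Γ : Env) (U : Ty) : Set where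
  constructor unsubst⟨_,_,_,_,_,_,_⟩
  field
    V        : Ty
    Δ        : Env
    Γᴾ       : Env
    typingC  : C ∶⟨ Δ ⊢ U ⟩
    Δ-z      : Δ z L ≡ just V
    typingP  : P ∶⟨ Γᴾ ⊢ V ⟩
    Γ≼Δ⊓Γᴾ   : ∀ x K → x ≢ z → Γ x K ≼ meet (Δ x K) (Γᴾ x K)

site-app₁ : ∀ {z L P C₁ C₂} → Site z L P (app C₁ C₂) → (z , L) ∈ fv C₁ → Site z L P C₁
site-app₁ {C₁ = C₁} s z∈ = record
  { termC = appᶜ-fun (termC s) ; termP = termP s ; degP = degP s ; freshP = freshP s
  ; occurs = z∈ ; onlyL = λ K h → onlyL s K (∈-++⁺ˡ h) }

site-app₂ : ∀ {z L P C₁ C₂} → Site z L P (app C₁ C₂) → (z , L) ∈ fv C₂ → Site z L P C₂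
site-app₂ {C₁ = C₁} s z∈ = record
  { termC = appᶜ-arg (termC s) ; termP = termP s ; degP = degP s ; freshP = freshP s
  ; occurs = z∈ ; onlyL = λ K h → onlyL s K (∈-++⁺ʳ (fv C₁) h) }

site-open : ∀ {z L P L' C y} → Site z L P (lam L' C) → y ≢ z → Fresh y C → Site z L P (C ^^ fvar y L')
site-open {z} {L} {P} {L'} {C} {y} s y≢z frC = record
  { termC = lamᶜ-body (termC s) y frC ; termP = termP s ; degP = degP s ; freshP = freshP s
  ; occurs = fv-open⁺ 0 (fvar y L') C (occurs s)
  ; onlyL = λ K h → onlyL s K (fv-open-var⁻ y L' C (λ eq → y≢z (sym (cong proj₁ eq))) h) }

absent→Fresh : ∀ {z L} C → (∀ K → (z , K) ∈ fv C → K ≡ L) → (z , L) ∉ fv C → Fresh z C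
absent→Fresh {z} C onlyL z∉ K z∈ = z∉ (subst (λ t → (z , t) ∈ fv C) (onlyL K z∈) z∈)

Fresh-≔⁻ : ∀ {y z P} C → y ≢ z → Fresh y (C [ z ≔ P ]) → Fresh y C
Fresh-≔⁻ {y} {z} {P} C y≢z fr K y∈ = fr K (fv-≔⁺ z P C y∈ y≢z)

DomFv-≔-z : ∀ {Γ : Env} z P C K → Fresh z P → DomFv Γ (C [ z ≔ P ]) → Γ z K ≡ nothing
DomFv-≔-z {Γ} z P C K frP dom = not-just→nothing (Γ z K) (λ j → ≔-eliminates z P C K frP (proj₁ (dom z K) j))

unsubst-var : ∀ {Γ U z L P} → P ∶⟨ Γ ⊢ U ⟩ → deg P ≡ L → Unsubst z L P (fvar z L) Γ U
unsubst-var {Γ} {U} {z} {L} {P} D degP≡L =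
  unsubst⟨ U , sgl z L U , Γ , typingC , sgl-yes z L U z L refl , D , below ⟩
  where
  typingC : fvar z L ∶⟨ sgl z L U ⊢ U ⟩
  typingC = subst (λ t → fvar z t ∶⟨ sgl z t U ⊢ U ⟩) (trans (degree (generation D)) degP≡L)
                  (var-any-type z (isU (generation D)))
  below : ∀ x K → x ≢ z → Γ x K ≼ meet (sgl z L U x K) (Γ x K)
  below x K x≢z = subst (λ t → Γ x K ≼ meet t (Γ x K)) (sym (sgl-no z L U x K (λ eq → x≢z (cong proj₁ eq))))
                        (≼-refl (Γ x K))

envω-reading : ∀ M x K → ⟦ envω M x K ⟧ K ≡ ω K
envω-reading M x K with decFv (x , K) (fv M)
... | yes x∈ = cong (λ t → ⟦ t ⟧ K) (envω-yes M x K x∈)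
... | no x∉ = cong (λ t → ⟦ t ⟧ K) (envω-no M x K x∉)

envω-is-just⁻ : ∀ M x K → Is-just (envω M x K) → (x , K) ∈ fv M
envω-is-just⁻ M x K j = proj₁ (DomFv-envω M x K) j

envω-is-just⁺ : ∀ M x K → (x , K) ∈ fv M → Is-just (envω M x K)
envω-is-just⁺ M x K x∈ = proj₂ (DomFv-envω M x K) x∈

unsubst-ω : ∀ {z L P C} → Site z L P C → Unsubst z L P C (envω (C [ z ≔ P ])) (ω (deg (C [ z ≔ P ])))
unsubst-ω {z} {L} {P} {C} s =
  unsubst⟨ ω L , envω C , envω P , typingC , envω-yes C z L (occurs s) , typingP , below ⟩
  where
  X = C [ z ≔ P ]
  typingC : C ∶⟨ envω C ⊢ ω (deg X) ⟩
  typingC = subst (λ t → C ∶⟨ envω C ⊢ ω t ⟩) (sym (degAt-≔ z P L [] C (degAt-P s) (onlyL s)))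
                  (ωr (IsTermᶜ→IsTerm (termC s)))
  typingP : P ∶⟨ envω P ⊢ ω L ⟩
  typingP = subst (λ t → P ∶⟨ envω P ⊢ ω t ⟩) (degP s) (ωr (IsTermᶜ→IsTerm (termP s)))
  below : ∀ x K → x ≢ z → envω X x K ≼ meet (envω C x K) (envω P x K)
  below x K x≢z = SameDom→≼ _ _ (to , from) readings
    where
    to : Is-just (envω X x K) → Is-just (meet (envω C x K) (envω P x K))
    to j with fv-≔⁻ z P C (envω-is-just⁻ X x K j)
    ... | inj₁ x∈P = meet-is-justʳ (envω C x K) _ (envω-is-just⁺ P x K x∈P)
    ... | inj₂ (x∈C , _) = meet-is-justˡ (envω C x K) _ (envω-is-just⁺ C x K x∈C)
    from : Is-just (meet (envω C x K) (envω P x K)) → Is-just (envω X x K)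
    from j with meet-is-just⁻ (envω C x K) (envω P x K) j
    ... | inj₁ jC = envω-is-just⁺ X x K (fv-≔⁺ z P C (envω-is-just⁻ C x K jC) x≢z)
    ... | inj₂ jP = envω-is-just⁺ X x K (fv-≔-image z P C (occurs s) (envω-is-just⁻ P x K jP))
    readings : ⟦ envω X x K ⟧ K ⊑ ⟦ meet (envω C x K) (envω P x K) ⟧ K
    readings rewrite envω-reading X x K =
      ⊑-trans (⊑-⊓-idem (ω K))
        (≈⇒⊑ (≈-sym (subst₂ (λ a b → ⟦ meet (envω C x K) (envω P x K) ⟧ K ≈ (a ⊓ b))
                        (envω-reading C x K) (envω-reading P x K)
                        (⟦meet⟧ (envω C x K) (envω P x K) (Graded-envω C x K) (Graded-envω P x K)))))

-- The (→I) case: z^L and the abstracted y^{L'} are different variables, so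
-- y^{L'} moves from the environment of the reduct to that of C.
unsubst-⇒I : ∀ {Γ y L' C U₁ T z L P} → Site z L P (lam L' C) → y ≢ z → Fresh y (C [ z ≔ P ]) →
             Γ y L' ≡ nothing → IsT T → OfDeg L' U₁ →
             Unsubst z L P (C ^^ fvar y L') (extend Γ y L' U₁) T → Unsubst z L P (lam L' C) Γ (U₁ ⇒ T)
unsubst-⇒I {Γ} {y} {L'} {C} {U₁} {T} {z} {L} {P} s y≢z fr Γy isT gU₁ S =
  unsubst⟨ V , del y L' Δ , Γᴾ , typingλ , trans (del-no y L' Δ z L (λ eq → y≢z (sym (cong proj₁ eq)))) Δz ,
           typingP , below ⟩
  where
  open Unsubst S renaming (typingC to typingBody; Δ-z to Δz; Γ≼Δ⊓Γᴾ to below-body)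
  frC : Fresh y C
  frC = Fresh-≔⁻ C y≢z fr
  -- y^{L'} is not free in P, since P occurs in C [ z ≔ P ]
  Γᴾy : Γᴾ y L' ≡ nothing
  Γᴾy = not-just→nothing (Γᴾ y L')
          (λ j → fr L' (fv-≔-image z P C (occurs s) (proj₁ (dom (generation typingP) y L') j)))
  U₁≼Δy : just U₁ ≼ Δ y L'
  U₁≼Δy = subst₂ _≼_ (extend-yes Γ y L' U₁ y L' refl) (trans (cong (meet (Δ y L')) Γᴾy) (meet-nothingʳ (Δ y L')))
                     (below-body y L' y≢z)
  Δ' : Env
  Δ' = extend (del y L' Δ) y L' U₁
  Δ'≼Δ : ∀ x K → Δ' x K ≼ Δ x K
  Δ'≼Δ x K with decVar (x , K) (y , L')
  ... | yes refl = subst (_≼ Δ y L') (sym (extend-yes (del y L' Δ) y L' U₁ y L' refl)) U₁≼Δy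
  ... | no ne = ≡→≼ (trans (extend-no (del y L' Δ) y L' U₁ x K ne) (del-no y L' Δ x K ne))
  graded-Δ' : Graded Δ'
  graded-Δ' x K W eq with decVar (x , K) (y , L')
  ... | yes refl = subst (OfDeg L') (just-injective (trans (sym (extend-yes (del y L' Δ) y L' U₁ y L' refl)) eq)) gU₁
  ... | no ne = graded (generation typingBody) x K W
                  (trans (sym (trans (extend-no (del y L' Δ) y L' U₁ x K ne) (del-no y L' Δ x K ne))) eq)
  typingλ : lam L' C ∶⟨ del y L' Δ ⊢ U₁ ⇒ T ⟩
  typingλ = ⇒I y frC (del-yes y L' Δ y L' refl) (IsTermᶜ→IsTerm (termC s)) isT (retype typingBody Δ'≼Δ graded-Δ')
  below : ∀ x K → x ≢ z → Γ x K ≼ meet (del y L' Δ x K) (Γᴾ x K)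
  below x K x≢z with decVar (x , K) (y , L')
  ... | yes refl = subst₂ _≼_ (sym Γy) (sym (cong₂ meet (del-yes y L' Δ y L' refl) Γᴾy)) nothing
  ... | no ne = subst₂ (λ a b → a ≼ meet b (Γᴾ x K)) (extend-no Γ y L' U₁ x K ne) (sym (del-no y L' Δ x K ne))
                       (below-body x K x≢z)

-- The (→'I) case: y^{L'} is declared neither in Γ nor, therefore, in Δ.
unsubst-⇒I' : ∀ {Γ y L' C T z L P} → Site z L P (lam L' C) → y ≢ z → Fresh y (C [ z ≔ P ]) →
              Γ y L' ≡ nothing → IsT T →
              Unsubst z L P (C ^^ fvar y L') Γ T → Unsubst z L P (lam L' C) Γ (ω L' ⇒ T)
unsubst-⇒I' {Γ} {y} {L'} {C} s y≢z fr Γy isT S =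
  unsubst⟨ V , Δ , Γᴾ , ⇒I' y (Fresh-≔⁻ C y≢z fr) Δy (IsTermᶜ→IsTerm (termC s)) isT typingC , Δ-z , typingP , Γ≼Δ⊓Γᴾ ⟩
  where
  open Unsubst S
  Δy : Δ y L' ≡ nothing
  Δy = proj₁ (meet-nothing⁻ (Δ y L') (Γᴾ y L') (subst (_≼ meet (Δ y L') (Γᴾ y L')) Γy (Γ≼Δ⊓Γᴾ y L' y≢z)))

unsubst-merge : ∀ {z L P C C₁ C₂ Γ₁ Γ₂ U U₁ U₂} (S₁ : Unsubst z L P C₁ Γ₁ U₁) (S₂ : Unsubst z L P C₂ Γ₂ U₂) →
                Graded Γ₁ → Graded Γ₂ → C ∶⟨ Unsubst.Δ S₁ ⊓ᴱ Unsubst.Δ S₂ ⊢ U ⟩ →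
                Unsubst z L P C (Γ₁ ⊓ᴱ Γ₂) U
unsubst-merge {z} {L} {Γ₁ = Γ₁} {Γ₂} S₁ S₂ g₁ g₂ typingC =
  unsubst⟨ S₁.V ⊓ S₂.V , S₁.Δ ⊓ᴱ S₂.Δ , S₁.Γᴾ ⊓ᴱ S₂.Γᴾ , typingC , cong₂ meet S₁.Δ-z S₂.Δ-z ,
           ⊓I-⊓ᴱ S₁.typingP S₂.typingP (trans (degV S₁) (sym (degV S₂))) , below ⟩
  where
  module S₁ = Unsubst S₁
  module S₂ = Unsubst S₂
  degV : ∀ {C' Γ' U'} (S : Unsubst z L _ C' Γ' U') → tdeg (Unsubst.V S) ≡ L
  degV S = proj₂ (graded (generation (Unsubst.typingC S)) z L (Unsubst.V S) (Unsubst.Δ-z S))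
  below : ∀ x K → x ≢ z → (Γ₁ ⊓ᴱ Γ₂) x K ≼ meet ((S₁.Δ ⊓ᴱ S₂.Δ) x K) ((S₁.Γᴾ ⊓ᴱ S₂.Γᴾ) x K)
  below x K x≢z =
    meet-interchange-≼ (Γ₁ x K) (Γ₂ x K) (S₁.Δ x K) (S₂.Δ x K) (S₁.Γᴾ x K) (S₂.Γᴾ x K)
      (g₁ x K) (g₂ x K) (graded (generation S₁.typingC) x K) (graded (generation S₂.typingC) x K)
      (graded (generation S₁.typingP) x K) (graded (generation S₂.typingP) x K)
      (S₁.Γ≼Δ⊓Γᴾ x K x≢z) (S₂.Γ≼Δ⊓Γᴾ x K x≢z)

unsubst-≼ : ∀ {z L P C Γ Γ' U} → (∀ x K → Γ' x K ≼ Γ x K) → Unsubst z L P C Γ U → Unsubst z L P C Γ' U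
unsubst-≼ Γ'≼Γ S = unsubst⟨ V , Δ , Γᴾ , typingC , Δ-z , typingP , (λ x K x≢z → ≼-trans (Γ'≼Γ x K) (Γ≼Δ⊓Γᴾ x K x≢z)) ⟩
  where open Unsubst S

unsubst-app₁ : ∀ {z L P C₁ C₂ Γ₁ Γ₂ W T} → Site z L P (app C₁ C₂) → IsT T → Graded Γ₁ →
               Unsubst z L P C₁ Γ₁ (W ⇒ T) → C₂ ∶⟨ Γ₂ ⊢ W ⟩ → Γ₂ z L ≡ nothing →
               Unsubst z L P (app C₁ C₂) (Γ₁ ⊓ᴱ Γ₂) T
unsubst-app₁ {z} {L} {Γ₁ = Γ₁} {Γ₂} s isT g₁ S D₂ Γ₂z =
  unsubst⟨ V , Δ ⊓ᴱ Γ₂ , Γᴾ , ⇒E' typingC D₂ (termC s) isT , cong₂ meet Δ-z Γ₂z , typingP , below ⟩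
  where
  open Unsubst S
  g₂ = graded (generation D₂)
  below : ∀ x K → x ≢ z → (Γ₁ ⊓ᴱ Γ₂) x K ≼ meet ((Δ ⊓ᴱ Γ₂) x K) (Γᴾ x K)
  below x K x≢z = subst (λ t → (Γ₁ ⊓ᴱ Γ₂) x K ≼ meet ((Δ ⊓ᴱ Γ₂) x K) t) (meet-nothingʳ (Γᴾ x K))
    (meet-interchange-≼ (Γ₁ x K) (Γ₂ x K) (Δ x K) (Γ₂ x K) (Γᴾ x K) nothing
      (g₁ x K) (g₂ x K) (graded (generation typingC) x K) (g₂ x K) (graded (generation typingP) x K) OptOfDeg-nothing
      (Γ≼Δ⊓Γᴾ x K x≢z) (≡→≼ (sym (meet-nothingʳ (Γ₂ x K)))))

unsubst-app₂ : ∀ {z L P C₁ C₂ Γ₁ Γ₂ W T} → Site z L P (app C₁ C₂) → IsT T → Graded Γ₂ →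
               C₁ ∶⟨ Γ₁ ⊢ W ⇒ T ⟩ → Γ₁ z L ≡ nothing → Unsubst z L P C₂ Γ₂ W →
               Unsubst z L P (app C₁ C₂) (Γ₁ ⊓ᴱ Γ₂) T
unsubst-app₂ {z} {L} {Γ₁ = Γ₁} {Γ₂} s isT g₂ D₁ Γ₁z S =
  unsubst⟨ V , Γ₁ ⊓ᴱ Δ , Γᴾ , ⇒E' D₁ typingC (termC s) isT , cong₂ meet Γ₁z Δ-z , typingP , below ⟩
  where
  open Unsubst S
  g₁ = graded (generation D₁)
  below : ∀ x K → x ≢ z → (Γ₁ ⊓ᴱ Γ₂) x K ≼ meet ((Γ₁ ⊓ᴱ Δ) x K) (Γᴾ x K)
  below x K x≢z =
    meet-interchange-≼ (Γ₁ x K) (Γ₂ x K) (Γ₁ x K) (Δ x K) nothing (Γᴾ x K)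
      (g₁ x K) (g₂ x K) (g₁ x K) (graded (generation typingC) x K) OptOfDeg-nothing (graded (generation typingP) x K)
      (≡→≼ (sym (meet-nothingʳ (Γ₁ x K)))) (Γ≼Δ⊓Γᴾ x K x≢z)

unsubst-e : ∀ j {z L P C Γ U} → Unsubst z L P C Γ U →
            Unsubst z (j ∷ L) (lift j P) (lift j C) (ēᴱ j Γ) (ē j U)
unsubst-e j {z} {L} {P} {C} {Γ} S =
  unsubst⟨ ē j V , ēᴱ j Δ , ēᴱ j Γᴾ , e j typingC , trans (ēᴱ-yes j Δ z L) (cong (mapMaybe (ē j)) Δ-z) ,
           e j typingP , below ⟩
  where
  open Unsubst S
  below : ∀ x K → x ≢ z → ēᴱ j Γ x K ≼ meet (ēᴱ j Δ x K) (ēᴱ j Γᴾ x K)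
  below x [] x≢z = nothing
  below x (i ∷ K) x≢z with decName i j
  ... | yes refl = subst₂ _≼_ (sym (ēᴱ-yes i Γ x K)) (sym (cong₂ meet (ēᴱ-yes i Δ x K) (ēᴱ-yes i Γᴾ x K)))
                     (map-ē-≼ i (Γ x K) (Δ x K) (Γᴾ x K) (graded (generation typingC) x K)
                              (graded (generation typingP) x K) (Γ≼Δ⊓Γᴾ x K x≢z))
  ... | no i≢j = subst₂ _≼_ (sym (ēᴱ-no j Γ x i K i≢j)) (sym (cong₂ meet (ēᴱ-no j Δ x i K i≢j) (ēᴱ-no j Γᴾ x i K i≢j)))
                   nothing

unsubst-⊑ : ∀ {z L P C Γ U U'} → U ⊑ U' → IsU U' → Unsubst z L P C Γ U → Unsubst z L P C Γ U'
unsubst-⊑ U⊑U' isU' S =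
  unsubst⟨ V , Δ , Γᴾ , sub typingC U⊑U' (λ x K → ≼-refl (Δ x K)) isU' (Graded→WfEnv (graded (generation typingC))) ,
           Δ-z , typingP , Γ≼Δ⊓Γᴾ ⟩
  where open Unsubst S

data UnliftedSite (j z : ℕ) (X' : Tm) : Index → Tm → Tm → Set where
  unlifted : ∀ {L' P' C'} → Site z L' P' C' → X' ≡ C' [ z ≔ P' ] → UnliftedSite j z X' (j ∷ L') (lift j P') (lift j C')

site-unlift : ∀ j {X' z L P C} → Site z L P C → lift j X' ≡ C [ z ≔ P ] → IsTermᶜ X' → UnliftedSite j z X' L P C
site-unlift j {X'} {z} {L} {P} {C} s eq tX'
  with deg-∷⇒lift j (deg X') (termC s)
         (trans (sym (degAt-≔ z P L [] C (degAt-P s) (onlyL s))) (trans (sym (cong deg eq)) (deg-lift j tX')))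
... | (C' , refl) with fv-lift⁻ j C' (occurs s)
... | (L' , refl , z∈C') with deg-∷⇒lift j L' (termP s) (degP s)
... | (P' , refl) = unlifted s' (lift-injective j X' (C' [ z ≔ P' ]) (trans eq (sym (lift-≔ j z P' C'))))
  where
  tP' = IsTermᶜ-unlift j (termP s) P' refl
  s' : Site z L' P' C'
  s' = record
    { termC = IsTermᶜ-unlift j (termC s) C' refl ; termP = tP'
    ; degP = LP.∷-injectiveʳ (trans (sym (deg-lift j tP')) (degP s))
    ; freshP = Fresh-lift⁻ j z P' (freshP s) ; occurs = z∈C'
    ; onlyL = λ K h → LP.∷-injectiveʳ (onlyL s (j ∷ K) (fv-lift⁺ j C' h)) }

unsubst-app : ∀ {z L P C₁ C₂ Γ₁ Γ₂ W T} → Site z L P (app C₁ C₂) → IsT T →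
              C₁ [ z ≔ P ] ∶⟨ Γ₁ ⊢ W ⇒ T ⟩ → C₂ [ z ≔ P ] ∶⟨ Γ₂ ⊢ W ⟩ →
              ((z , L) ∈ fv C₁ → Unsubst z L P C₁ Γ₁ (W ⇒ T)) → ((z , L) ∈ fv C₂ → Unsubst z L P C₂ Γ₂ W) →
              Unsubst z L P (app C₁ C₂) (Γ₁ ⊓ᴱ Γ₂) T
unsubst-app {z} {L} {P} {C₁} {C₂} s isT D₁ D₂ split₁ split₂ with decFv (z , L) (fv C₁) | decFv (z , L) (fv C₂)
... | yes z∈₁ | yes z∈₂ =
  unsubst-merge S₁ S₂ (graded (generation D₁)) (graded (generation D₂))
    (⇒E' (Unsubst.typingC S₁) (Unsubst.typingC S₂) (termC s) isT)
  where
  S₁ = split₁ z∈₁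
  S₂ = split₂ z∈₂
... | yes z∈₁ | no z∉₂ =
  unsubst-app₁ s isT (graded (generation D₁)) (split₁ z∈₁)
    (subst (λ t → t ∶⟨ _ ⊢ _ ⟩) (≔-fresh z P C₂ (absent→Fresh C₂ (λ K h → onlyL s K (∈-++⁺ʳ (fv C₁) h)) z∉₂)) D₂)
    (DomFv-≔-z z P C₂ L (freshP s) (dom (generation D₂)))
... | no z∉₁ | yes z∈₂ =
  unsubst-app₂ s isT (graded (generation D₂))
    (subst (λ t → t ∶⟨ _ ⊢ _ ⟩) (≔-fresh z P C₁ (absent→Fresh C₁ (λ K h → onlyL s K (∈-++⁺ˡ h)) z∉₁)) D₁)
    (DomFv-≔-z z P C₁ L (freshP s) (dom (generation D₁)))
    (split₂ z∈₂)
... | no z∉₁ | no z∉₂ with ∈-++⁻ (fv C₁) (occurs s)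
...   | inj₁ z∈₁ = ⊥-elim (z∉₁ z∈₁)
...   | inj₂ z∈₂ = ⊥-elim (z∉₂ z∈₂)

maxBinder : ∀ {M Γ U} → M ∶⟨ Γ ⊢ U ⟩ → ℕ
maxBinder (ax _) = 0
maxBinder (ωr _) = 0
maxBinder (⇒I y _ _ _ _ D) = y ⊔ maxBinder D
maxBinder (⇒I' y _ _ _ _ D) = y ⊔ maxBinder D
maxBinder (⇒E D₁ D₂ _ _ _) = maxBinder D₁ ⊔ maxBinder D₂
maxBinder (⊓I D₁ D₂ _) = maxBinder D₁ ⊔ maxBinder D₂
maxBinder (e _ D) = maxBinder D
maxBinder (sub D _ _ _ _) = maxBinder D

data Compound : Tm → Set where
  app : ∀ {A B} → Compound (app A B)
  lam : ∀ {K A} → Compound (lam K A)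

mutual
  unsubst : ∀ {X Γ U} (D : X ∶⟨ Γ ⊢ U ⟩) {z L P C} → X ≡ C [ z ≔ P ] → maxBinder D < z → Site z L P C →
            Unsubst z L P C Γ U
  unsubst D {C = fvar y K} eq bd s with occurs s
  ... | here refl = unsubst-var (subst (λ t → t ∶⟨ _ ⊢ _ ⟩) (trans eq (≔-here y _ K)) D) (degP s)
  unsubst D {C = bvar i} eq bd s with occurs s
  ... | ()
  unsubst D {C = app C₁ C₂} eq bd s = unsubst-compound D app eq bd s
  unsubst D {C = lam K C} eq bd s = unsubst-compound D lam eq bd s

  unsubst-compound : ∀ {X Γ U} (D : X ∶⟨ Γ ⊢ U ⟩) {z L P C} → Compound C → X ≡ C [ z ≔ P ] →
                     maxBinder D < z → Site z L P C → Unsubst z L P C Γ U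
  unsubst-compound (ax _) app () _ _
  unsubst-compound (ax _) lam () _ _
  unsubst-compound (ωr _) _ refl _ s = unsubst-ω s
  unsubst-compound (⇒I {Γ} {U = U₁} y fr Γy _ isT D) {z} {L} {P} {lam L' C} lam refl bd s =
    unsubst-⇒I s y≢z fr Γy isT (graded (generation D) y L' U₁ (extend-yes Γ y L' U₁ y L' refl))
      (unsubst D (≔-open-var z P y L' C y≢z (IsTermᶜ→lc (termP s))) (NP.m⊔n<o⇒n<o y _ bd)
               (site-open s y≢z (Fresh-≔⁻ C y≢z fr)))
    where
    y≢z : y ≢ z
    y≢z = NP.<⇒≢ (NP.m⊔n<o⇒m<o y _ bd)
  unsubst-compound (⇒I' y fr Γy _ isT D) {z} {L} {P} {lam L' C} lam refl bd s =
    unsubst-⇒I' s y≢z fr Γy isT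
      (unsubst D (≔-open-var z P y L' C y≢z (IsTermᶜ→lc (termP s))) (NP.m⊔n<o⇒n<o y _ bd)
               (site-open s y≢z (Fresh-≔⁻ C y≢z fr)))
    where
    y≢z : y ≢ z
    y≢z = NP.<⇒≢ (NP.m⊔n<o⇒m<o y _ bd)
  unsubst-compound (⇒E D₁ D₂ _ _ isT) app refl bd s =
    unsubst-app s isT D₁ D₂ (λ z∈ → unsubst D₁ refl (NP.m⊔n<o⇒m<o _ _ bd) (site-app₁ s z∈))
                            (λ z∈ → unsubst D₂ refl (NP.m⊔n<o⇒n<o _ _ bd) (site-app₂ s z∈))
  unsubst-compound (⊓I {Γ} D₁ D₂ eqdeg) c eq bd s =
    unsubst-≼ (λ x K → meet-idem-≼ (Γ x K) (g x K))
      (unsubst-merge S₁ S₂ g g (⊓I-⊓ᴱ (Unsubst.typingC S₁) (Unsubst.typingC S₂) eqdeg))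
    where
    S₁ = unsubst-compound D₁ c eq (NP.m⊔n<o⇒m<o _ _ bd) s
    S₂ = unsubst-compound D₂ c eq (NP.m⊔n<o⇒n<o _ _ bd) s
    g = graded (generation D₁)
  unsubst-compound (sub D U⊑U' Γ'≼Γ isU' _) c eq bd s =
    unsubst-≼ Γ'≼Γ (unsubst-⊑ U⊑U' isU' (unsubst-compound D c eq bd s))
  unsubst-compound (e j D) c eq bd s with site-unlift j s eq (term (generation D))
  ... | unlifted s' eq' = unsubst-e j (unsubst D eq' bd s')

-- Expanding a β-redex

↑-⊓ᴱ-envω : ∀ (Γ : Env) M P → Graded Γ → (∀ {a} → a ∈ fv P → a ∈ fv M) →
            (∀ x K → (x , K) ∈ fv M → Is-just (Γ x K) ⊎ (x , K) ∈ fv P) →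
            ∀ x K → (Γ ↑ M) x K ≼ (Γ ⊓ᴱ envω P) x K
↑-⊓ᴱ-envω Γ M P g P⊆M M⊆ΓP x K with just-or-nothing (Γ x K) | decFv (x , K) (fv P)
... | inj₁ (A , eq) | yes x∈P =
  subst₂ _≼_ (sym (↑-just {Γ} {M} eq)) (sym (cong₂ meet eq (envω-yes P x K x∈P)))
         (just (≈⇒⊑ (⟦meet⟧ {K} (just A) nothing (OptOfDeg-just (g x K A eq)) OptOfDeg-nothing)))
... | inj₁ (A , eq) | no x∉P = ≡→≼ (trans (↑-just {Γ} {M} eq) (sym (cong₂ meet eq (envω-no P x K x∉P))))
... | inj₂ eq | yes x∈P =
  ≡→≼ (trans (↑-nothing {Γ} {M} eq) (trans (envω-yes M x K (P⊆M x∈P)) (sym (cong₂ meet eq (envω-yes P x K x∈P)))))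
... | inj₂ eq | no x∉P =
  ≡→≼ (trans (↑-nothing {Γ} {M} eq) (trans (envω-no M x K x∉M) (sym (cong₂ meet eq (envω-no P x K x∉P)))))
  where
  x∉M : (x , K) ∉ fv M
  x∉M x∈M with M⊆ΓP x K x∈M
  ... | inj₁ j = not-just-≡ eq j
  ... | inj₂ x∈P = x∉P x∈P

record Redex (L : Index) (B P : Tm) (z : ℕ) : Set where
  field
    termM     : IsTermᶜ (app (lam L B) P)
    degArg    : deg P ≡ L
    freshBody : Fresh z B
    freshArg  : Fresh z P

module _ {L B P z} (r : Redex L B P z) where
  open Redex r

  private
    M = app (lam L B) P
    C = B ^^ fvar z L

  termλ : IsTermᶜ (lam L B)
  termλ = appᶜ-fun termM

  reduct≡ : B ^^ P ≡ C [ z ≔ P ]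
  reduct≡ = open-as-≔ z P L B freshBody (IsTermᶜ→lc (appᶜ-arg termM))

  z-only-L : ∀ K → (z , K) ∈ fv C → K ≡ L
  z-only-L K h with fv-open⁻ 0 (fvar z L) B h
  ... | inj₁ (here eq) = cong proj₂ eq
  ... | inj₂ z∈B = ⊥-elim (freshBody K z∈B)

  fvB⊆reduct : ∀ {x K} → (x , K) ∈ fv B → (x , K) ∈ fv (C [ z ≔ P ])
  fvB⊆reduct {x} {K} x∈ = fv-≔⁺ z P C (fv-open⁺ 0 (fvar z L) B x∈) (λ { refl → freshBody K x∈ })

  expand-β-discard : ∀ {Γ T} → C [ z ≔ P ] ∶⟨ Γ ⊢ T ⟩ → IsT T → (z , L) ∉ fv C → M ∶⟨ Γ ↑ M ⊢ T ⟩
  expand-β-discard {Γ} {T} D isT z∉ =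
    retype (⇒E' typingλ typingP termM isT)
           (↑-⊓ᴱ-envω Γ M P (graded G) (∈-++⁺ʳ (fv B)) M⊆ΓP)
           (Graded-↑ M (graded G))
    where
    G = generation D
    typingλ : lam L B ∶⟨ Γ ⊢ ω L ⇒ T ⟩
    typingλ = ⇒I' z freshBody (DomFv-≔-z z P C L freshArg (dom G)) (IsTermᶜ→IsTerm termλ) isT
                (subst (λ t → t ∶⟨ Γ ⊢ T ⟩) (≔-fresh z P C (absent→Fresh C z-only-L z∉)) D)
    typingP : P ∶⟨ envω P ⊢ ω L ⟩
    typingP = subst (λ t → P ∶⟨ envω P ⊢ ω t ⟩) degArg (ωr (IsTermᶜ→IsTerm (appᶜ-arg termM)))
    M⊆ΓP : ∀ x K → (x , K) ∈ fv M → Is-just (Γ x K) ⊎ (x , K) ∈ fv P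
    M⊆ΓP x K x∈ with ∈-++⁻ (fv B) x∈
    ... | inj₁ x∈B = inj₁ (proj₂ (dom G x K) (fvB⊆reduct x∈B))
    ... | inj₂ x∈P = inj₂ x∈P

  ↑-unsubst : ∀ {Γ T} → DomFv Γ (C [ z ≔ P ]) → (S : Unsubst z L P C Γ T) →
              ∀ x K → (Γ ↑ M) x K ≼ meet (del z L (Unsubst.Δ S) x K) (Unsubst.Γᴾ S x K)
  ↑-unsubst {Γ} domΓ S x K with decName x z
  ... | yes refl = subst₂ _≼_ (sym (trans (↑-nothing {Γ} {M} (DomFv-≔-z z P C K freshArg domΓ)) (envω-no M z K z∉M)))
                              (sym (cong₂ meet del-z Γᴾ-z)) nothing
    where
    open Unsubst S
    z∉M : (z , K) ∉ fv M
    z∉M z∈ with ∈-++⁻ (fv B) z∈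
    ... | inj₁ z∈B = freshBody K z∈B
    ... | inj₂ z∈P = freshArg K z∈P
    Γᴾ-z : Γᴾ z K ≡ nothing
    Γᴾ-z = not-just→nothing (Γᴾ z K) (λ j → freshArg K (proj₁ (dom (generation typingP) z K) j))
    -- z is declared in Δ with index L only
    del-z : del z L Δ z K ≡ nothing
    del-z with decVar (z , K) (z , L)
    ... | yes eq = del-yes z L Δ z K eq
    ... | no ne = not-just→nothing _ (λ j → ne (cong (z ,_) (z-only-L K (proj₁ (dom (generation typingC) z K)
                    (subst Is-just (del-no z L Δ z K ne) j)))))
  ... | no x≢z with just-or-nothing (Γ x K)
  ...   | inj₁ (A , eq) = subst₂ _≼_ (trans eq (sym (↑-just {Γ} {M} eq))) (cong (λ t → meet t (Γᴾ x K)) (sym del-x))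
                            (Γ≼Δ⊓Γᴾ x K x≢z)
    where
    open Unsubst S
    del-x = del-no z L Δ x K (λ e → x≢z (cong proj₁ e))
  ...   | inj₂ eq with meet-nothing⁻ (Unsubst.Δ S x K) (Unsubst.Γᴾ S x K) (subst (_≼ _) eq (Unsubst.Γ≼Δ⊓Γᴾ S x K x≢z))
  ...     | (Δx , Γᴾx) = subst₂ _≼_ (sym (trans (↑-nothing {Γ} {M} eq) (envω-no M x K x∉M)))
                           (sym (cong₂ meet (trans (del-no z L (Unsubst.Δ S) x K (λ e → x≢z (cong proj₁ e))) Δx) Γᴾx))
                           nothing
    where
    -- x^K is declared neither in Δ nor in Γᴾ, so it is not free in M
    x∉M : (x , K) ∉ fv M
    x∉M x∈ with ∈-++⁻ (fv B) x∈
    ... | inj₁ x∈B = not-just-≡ Δx (proj₂ (dom (generation (Unsubst.typingC S)) x K) (fv-open⁺ 0 (fvar z L) B x∈B))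
    ... | inj₂ x∈P = not-just-≡ Γᴾx (proj₂ (dom (generation (Unsubst.typingP S)) x K) x∈P)

  -- If it is used, split the typing of the reduct by reverse substitution:
  -- the type V of z^L becomes the domain of the abstraction's type.
  expand-β-use : ∀ {Γ T} → C [ z ≔ P ] ∶⟨ Γ ⊢ T ⟩ → IsT T → Unsubst z L P C Γ T → M ∶⟨ Γ ↑ M ⊢ T ⟩
  expand-β-use {Γ} {T} D isT S =
    retype (⇒E' typingλ typingP termM isT) (↑-unsubst (dom (generation D)) S) (Graded-↑ M (graded (generation D)))
    where
    open Unsubst S
    typingλ : lam L B ∶⟨ del z L Δ ⊢ V ⇒ T ⟩
    typingλ = ⇒I z freshBody (del-yes z L Δ z L refl) (IsTermᶜ→IsTerm termλ) isT
                (retype-≡ typingC (extend-del Δ z L V Δ-z))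

  expand-β-fresh : ∀ {X Γ T} (D : X ∶⟨ Γ ⊢ T ⟩) → X ≡ B ^^ P → IsT T → maxBinder D < z → M ∶⟨ Γ ↑ M ⊢ T ⟩
  expand-β-fresh {X} {Γ} {T} D X≡ isT bd with decFv (z , L) (fv C)
  ... | no z∉ = expand-β-discard D' isT z∉
    where D' = subst (λ t → t ∶⟨ Γ ⊢ T ⟩) (trans X≡ reduct≡) D
  ... | yes z∈ = expand-β-use D' isT (unsubst D (trans X≡ reduct≡) bd site)
    where
    D' = subst (λ t → t ∶⟨ Γ ⊢ T ⟩) (trans X≡ reduct≡) D
    site : Site z L P C
    site = record { termC = lamᶜ-body termλ z freshBody ; termP = appᶜ-arg termM ; degP = degArg
                  ; freshP = freshArg ; occurs = z∈ ; onlyL = z-only-L }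

expand-β : ∀ {L B P X Γ T} → IsTermᶜ (app (lam L B) P) → deg P ≡ L → X ∶⟨ Γ ⊢ T ⟩ → X ≡ B ^^ P → IsT T →
           app (lam L B) P ∶⟨ Γ ↑ app (lam L B) P ⊢ T ⟩
expand-β {L} {B} {P} tM degP≡L D X≡ isT = expand-β-fresh redex D X≡ isT (freshFor₂-above B P _)
  where
  z = freshFor₂ B P (maxBinder D)
  redex : Redex L B P z
  redex = record { termM = tM ; degArg = degP≡L ; freshBody = freshFor₂-fresh₁ B P _ ; freshArg = freshFor₂-fresh₂ B P _ }

-- Subject expansion

-- One step: if M ▷h N and N : ⟨ Γ ⊢ U ⟩ then M : ⟨ Γ ↑ M ⊢ U ⟩.  By induction
-- on the typing of N (passed with an equation, as N is not a pattern).
expand-▷ : ∀ {M N X Γ U} → IsTermᶜ M → M ▷h N → X ∶⟨ Γ ⊢ U ⟩ → X ≡ N → M ∶⟨ Γ ↑ M ⊢ U ⟩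
expand-▷ {M} tM s (ωr {N} _) refl =
  retype-≡ (subst (λ t → M ∶⟨ envω M ⊢ ω t ⟩) (▷-deg tM s) (ωr (IsTermᶜ→IsTerm tM))) (envω-↑ N M (▷-fv s))
expand-▷ tM s (⊓I D₁ D₂ eq) refl = ⊓I (expand-▷ tM s D₁ refl) (expand-▷ tM s D₂ refl) eq
expand-▷ {M} tM s (sub {Γ} {Γ'} D U⊑U' Γ'≼Γ isU' wf) refl =
  sub (expand-▷ tM s D refl) U⊑U' (λ x K → ↑-mono {Γ} {Γ'} M x K (Γ'≼Γ x K)) isU'
      (Graded→WfEnv (Graded-↑ M (graded (generation (sub D U⊑U' Γ'≼Γ isU' wf)))))
expand-▷ tM s (e {Γ} {N'} j D) refl
  with deg-∷⇒lift j (deg N') tM (trans (▷-deg tM s) (deg-lift j (term (generation D))))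
... | (M' , refl) =
  retype (e j (expand-▷ tM' (unlift-▷ j s tM' refl refl) D refl)) (↑-ēᴱ j Γ M')
         (Graded-↑ (lift j M') (graded (generation (e j D))))
  where tM' = IsTermᶜ-unlift j tM M' refl
expand-▷ tM (β degP) D@(ax isT) eq = expand-β tM degP D eq isT
expand-▷ tM (β degP) D@(⇒I _ _ _ _ _ _) eq with isU (generation D)
... | ty isT = expand-β tM degP D eq isT
expand-▷ tM (β degP) D@(⇒I' _ _ _ _ isT _) eq = expand-β tM degP D eq (arr (ω _) isT)
expand-▷ tM (β degP) D@(⇒E _ _ _ _ isT) eq = expand-β tM degP D eq isT
expand-▷ {app M₁ P} tM (appL s) (⇒E {Γ₁} {Γ₂} D₁ D₂ j tMP isT) refl =
  retype (⇒E' (expand-▷ (appᶜ-fun tM) s D₁ refl) D₂ tM isT)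
         (λ x K → ↑-⊓ᴱ Γ₁ Γ₂ M₁ P x K (dom (generation D₂)) (graded (generation D₂) x K))
         (Graded-↑ (app M₁ P) (graded (generation (⇒E D₁ D₂ j tMP isT))))

-- Many steps: by induction on M ▷h* N, using (Γ ↑ M₁) ↑ M = Γ ↑ M for M ▷h M₁.
expand-▷* : ∀ {M N Γ U} → IsTermᶜ M → M ▷h* N → N ∶⟨ Γ ⊢ U ⟩ → M ∶⟨ Γ ↑ M ⊢ U ⟩
expand-▷* tM ε D = retype-≡ D (↑-DomFv (dom (generation D)))
expand-▷* {M} {Γ = Γ} tM (_◅_ {j = M₁} s ss) D =
  retype-≡ (expand-▷ tM s (expand-▷* (▷-IsTermᶜ tM s) ss D) refl) (↑-↑ {Γ} {M} {M₁} (▷-fv s))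

corollary2 : ∀ {M N : Tm} {Γ : Env} {U : Ty} →
    IsTerm M → M ▷h* N → N ∶⟨ Γ ⊢ U ⟩ → M ∶⟨ Γ ↑ M ⊢ U ⟩
corollary2 tM reductions D = expand-▷* (IsTerm→IsTermᶜ tM) reductions D
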